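{- Let $\lambda\in\mathbf{k}$. The quintuple $(\mathrm{ADF},m,\bullet,\Delta,\epsilon)$, where $m_{X,Y}(F\otimes G)=F\diamond G$, is a twisted bialgebra.
   Context: $\mathbf{k}$ is a field of characteristic zero. Species: functors from finite sets with bijections to $\mathbf{k}$-vector spaces; Cauchy product $(P\otimes Q)[X]=\bigoplus_{X_1\sqcup X_2=X}P[X_1]\otimes Q[X_2]$; $1_{\mathbf{k}}$ has $1_{\mathbf{k}}[\emptyset]=\mathbf{k}$ and $0$ elsewhere. A twisted algebra is a species with natural, associative, unital products $m_{X,Y}:P[X]\otimes P[Y]\to P[X\sqcup Y]$; if $P,Q$ are twisted algebras, $P\otimes Q$ is a twisted algebra with $(p_1\otimes q_1)(p_2\otimes q_2)=p_1p_2\otimes q_1q_2$. A twisted coalgebra is a species with morphisms $\Delta:P\to P\otimes P$, $\varepsilon:P\to1_{\mathbf{k}}$ that are coassociative and counital. A twisted bialgebra is a twisted algebra $(P,m,1_P)$ that is also a twisted coalgebra $(P,\Delta,\varepsilon)$ such that $\Delta$ and $\varepsilon$ are morphisms of twisted algebras. A Rota–Baxter species of weight $\lambda$ is a twisted algebra with a morphism $R$ satisfying $m_{X,Y}(R_Xx\otimes R_Yy)=R_{X\sqcup Y}m_{X,Y}(R_Xx\otimes y+x\otimes R_Yy+\lambda x\otimes y)$; morphisms of Rota–Baxter species preserve product, unit and operator. For a finite set $X$, $\mathrm{ADF}[X]$ has basis the planar rooted forests with exactly $|X|$ angles (gaps between consecutive leaves, inside a tree or between adjacent trees) decorated bijectively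 by $X$, written $T_1x_1\cdots x_mT_{m+1}$; $\bullet$ is the one-vertex tree and $\bullet x\bullet$ is two one-vertex trees separated by an angle decorated $x$. $R_X=B^+$ adds a new root joined to all roots. The product $\diamond$ (weight $\lambda$) is defined bilinearly by induction on depth: for trees $\bullet\diamond T'=T'$, $T\diamond\bullet=T$, $B^+(A)\diamond B^+(A')=B^+(B^+(A)\diamond A')+B^+(A\diamond B^+(A'))+\lambda B^+(A\diamond A')$; for forests $F\diamond G=T_1x_1\cdots x_m(T_{m+1}\diamond T'_1)y_1\cdots y_nT'_{n+1}$. $(\mathrm{ADF},\diamond,\bullet,B^+)$ is the free Rota–Baxter species of weight $\lambda$ on the species $O$ with $O[\{x\}]=\mathbf{k}\bullet x\bullet$ and $O[X]=0$ for non-singletons. $\epsilon:\mathrm{ADF}\to1_{\mathbf{k}}$: $\epsilon_\emptyset(\bullet)=1$, $\epsilon_X(F)=0$ for all other basis forests. $\mathrm{ADF}\otimes\mathrm{ADF}$ is the Rota–Baxter species with componentwise product and operator $R^{(2)}_X(F\otimes G)=B^+(F)\otimes G+\epsilon_{X_1}(F)\bullet\otimes B^+(G)$ for $F\in\mathrm{ADF}[X_1]$, $G\in\mathrm{ADF}[X\setminus X_1]$. $\Delta:\mathrm{ADF}\to\mathrm{ADF}\otimes\mathrm{ADF}$ is the unique morphism of Rota–Baxter species with $\Delta_{\{x\}}(\bullet x\bullet)=\bullet x\bullet\otimes\bullet+\bullet\otimes\bullet x\bullet$ for every singleton $\{x\}$. -}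

module Defs where

open import Level using (Level; _⊔_)
open import Algebra.Bundles using (CommutativeRing)
open import Data.Nat using (ℕ; zero; suc) renaming (_≟_ to _≟ℕ_)
open import Data.Nat.Properties using ()
open import Data.List using (List; []; _∷_; _++_; map; concatMap)
open import Data.List.Relation.Unary.Unique.Propositional using (Unique)
open import Data.List.Relation.Binary.Permutation.Propositional using (_↭_)
open import Data.List.Relation.Binary.Disjoint.Propositional using (Disjoint)
open import Data.Product using (Σ; ∃; _×_; _,_; proj₁; proj₂; map₂)
open import Data.Product.Properties using (≡-dec)
open import Relation.Nullary using (¬_; Dec; yes; no)
open import Relation.Binary.Definitions using (DecidableEquality)
open import Relation.Binary.PropositionalEquality using (_≡_; refl; cong; cong₂)
open import Function.Definitions using (Injective)

module _ {c ℓ : Level} (K : CommutativeRing c ℓ) where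
  open CommutativeRing K

  ℕ→K : ℕ → Carrier
  ℕ→K zero = 0#
  ℕ→K (suc n) = 1# + ℕ→K n

  IsField : Set (c ⊔ ℓ)
  IsField = (¬ (1# ≈ 0#)) × (∀ x → ¬ (x ≈ 0#) → Σ Carrier (λ y → x * y ≈ 1#))

  CharZero : Set ℓ
  CharZero = ∀ n → ℕ→K n ≈ 0# → n ≡ 0

-- Planar rooted forests with decorated angles, labels in ℕ.
-- A forest T₁ x₁ T₂ ⋯ xₘ Tₘ₊₁ is a nonempty alternating sequence.
-- A tree is either the one-vertex tree • (leaf) or B⁺(F) (node F).

mutual
  data Tree : Set where
    leaf : Tree
    node : Forest → Tree

  data Forest : Set where
    last  : Tree → Forest
    _⟨_⟩_ : Tree → ℕ → Forest → Forest

infixr 5 _⟨_⟩_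

∙ : Forest
∙ = last leaf

gen : ℕ → Forest
gen x = leaf ⟨ x ⟩ last leaf

B⁺ : Forest → Forest
B⁺ F = last (node F)

mutual
  labelsT : Tree → List ℕ
  labelsT leaf = []
  labelsT (node F) = labels F

  labels : Forest → List ℕ
  labels (last t) = labelsT t
  labels (t ⟨ x ⟩ F) = labelsT t ++ (x ∷ labels F)

-- basis forests of ADF[X]: decoration is a bijection onto X, i.e. the
-- labels are pairwise distinct (X = set of labels)
WellLabelled : Forest → Set
WellLabelled F = Unique (labels F)

-- relabelling along σ (species structure maps)
mutual
  relabelT : (ℕ → ℕ) → Tree → Tree
  relabelT σ leaf = leaf
  relabelT σ (node F) = node (relabel σ F)

  relabel : (ℕ → ℕ) → Forest → Forest
  relabel σ (last t) = last (relabelT σ t)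
  relabel σ (t ⟨ x ⟩ F) = relabelT σ t ⟨ σ x ⟩ relabel σ F

mutual
  _≟T_ : DecidableEquality Tree
  leaf ≟T leaf = yes refl
  leaf ≟T node _ = no (λ ())
  node _ ≟T leaf = no (λ ())
  node F ≟T node G with F ≟F G
  ... | yes refl = yes refl
  ... | no ne = no (λ { refl → ne refl })

  _≟F_ : DecidableEquality Forest
  last s ≟F last t with s ≟T t
  ... | yes refl = yes refl
  ... | no ne = no (λ { refl → ne refl })
  last _ ≟F (_ ⟨ _ ⟩ _) = no (λ ())
  (_ ⟨ _ ⟩ _) ≟F last _ = no (λ ())
  (s ⟨ x ⟩ F) ≟F (t ⟨ y ⟩ G) with s ≟T t | x ≟ℕ y | F ≟F G
  ... | yes refl | yes refl | yes refl = yes refl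
  ... | no ne | _ | _ = no (λ { refl → ne refl })
  ... | yes _ | no ne | _ = no (λ { refl → ne refl })
  ... | yes _ | yes _ | no ne = no (λ { refl → ne refl })

_≟F²_ : DecidableEquality (Forest × Forest)
_≟F²_ = ≡-dec _≟F_ _≟F_

_≟F³_ : DecidableEquality (Forest × Forest × Forest)
_≟F³_ = ≡-dec _≟F_ _≟F²_

module ADF {c ℓ : Level} (K : CommutativeRing c ℓ) where
  open CommutativeRing K

  V : Set → Set c
  V B = List (Carrier × B)

  ⟦_⟧ : {B : Set} → B → V B
  ⟦ b ⟧ = (1# , b) ∷ []

  _·ᵥ_ : {B : Set} → Carrier → V B → V B
  a ·ᵥ v = map (λ { (k , b) → (a * k , b) }) v

  mapV : {B C : Set} → (B → C) → V B → V C
  mapV f = map (map₂ f)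

  ext : {B C : Set} → (B → V C) → V B → V C
  ext f = concatMap (λ { (k , b) → k ·ᵥ f b })

  ext₂ : {B C D : Set} → (B → C → V D) → V B → V C → V D
  ext₂ f v w = ext (λ b → ext (λ c → f b c) w) v

  coeff : {B : Set} → DecidableEquality B → V B → B → Carrier
  coeff _≟_ [] b = 0#
  coeff _≟_ ((k , b') ∷ v) b with b' ≟ b
  ... | yes _ = k + coeff _≟_ v b
  ... | no _ = coeff _≟_ v b

  _≈[_]_ : {B : Set} → V B → DecidableEquality B → V B → Set ℓ
  v ≈[ d ] w = ∀ b → coeff d v b ≈ coeff d w b

  _≈₁_ : V Forest → V Forest → Set ℓ
  v ≈₁ w = v ≈[ _≟F_ ] w

  _≈₂_ : V (Forest × Forest) → V (Forest × Forest) → Set ℓ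
  v ≈₂ w = v ≈[ _≟F²_ ] w

  _≈₃_ : V (Forest × Forest × Forest) → V (Forest × Forest × Forest) → Set ℓ
  v ≈₃ w = v ≈[ _≟F³_ ] w

  infix 4 _≈₁_ _≈₂_ _≈₃_

  module Product (λ' : Carrier) where
    mutual
      _◇ₜ_ : Tree → Tree → V Tree
      leaf ◇ₜ t' = ⟦ t' ⟧
      node A ◇ₜ leaf = ⟦ node A ⟧
      node A ◇ₜ node A' =
        mapV node (tf (node A) A')
        ++ mapV node (ft A (node A'))
        ++ (λ' ·ᵥ mapV node (ff A A'))

      tf : Tree → Forest → V Forest
      tf t (last t') = mapV last (t ◇ₜ t')
      tf t (t' ⟨ x ⟩ F) = mapV (λ s → s ⟨ x ⟩ F) (t ◇ₜ t')

      ft : Forest → Tree → V Forest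
      ft (last s) t = mapV last (s ◇ₜ t)
      ft (s ⟨ x ⟩ F) t = mapV (λ G → s ⟨ x ⟩ G) (ft F t)

      -- forest ◇ forest : T₁x₁⋯xₘ(Tₘ₊₁ ◇ T'₁)y₁⋯yₙT'ₙ₊₁
      ff : Forest → Forest → V Forest
      ff (last s) G = tf s G
      ff (s ⟨ x ⟩ F) G = mapV (λ H → s ⟨ x ⟩ H) (ff F G)

    _◇_ : Forest → Forest → V Forest
    _◇_ = ff

    _◇ᵥ_ : V Forest → V Forest → V Forest
    _◇ᵥ_ = ext₂ _◇_

    _◇₂_ : V (Forest × Forest) → V (Forest × Forest) → V (Forest × Forest)
    _◇₂_ = ext₂ (λ { (F₁ , G₁) (F₂ , G₂) →
                    ext₂ (λ F G → ⟦ (F , G) ⟧) (F₁ ◇ F₂) (G₁ ◇ G₂) })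

  ε : Forest → Carrier
  ε F with F ≟F ∙
  ... | yes _ = 1#
  ... | no _ = 0#

  εᵥ : V Forest → Carrier
  εᵥ [] = 0#
  εᵥ ((k , F) ∷ v) = k * ε F + εᵥ v

  R² : Forest × Forest → V (Forest × Forest)
  R² (F , G) = ⟦ (B⁺ F , G) ⟧ ++ (ε F ·ᵥ ⟦ (∙ , B⁺ G) ⟧)

  -- Δ is given on basis forests: δ : Forest → V (Forest × Forest),
  -- extended linearly.  IsDelta δ: δ is a morphism of Rota–Baxter
  -- species ADF → ADF ⊗ ADF with Δ(•x•) = •x•⊗• + •⊗•x•.
  record IsDelta (λ' : Carrier) (δ : Forest → V (Forest × Forest)) : Set (c ⊔ ℓ) where
    open Product λ'
    field
      -- species morphism: Δ_X maps ADF[X] into (ADF⊗ADF)[X]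
      graded : ∀ F → WellLabelled F → ∀ G H →
               ¬ (labels G ++ labels H ↭ labels F) →
               coeff _≟F²_ (δ F) (G , H) ≈ 0#
      natural : ∀ (σ : ℕ → ℕ) → Injective _≡_ _≡_ σ → ∀ F → WellLabelled F →
                δ (relabel σ F) ≈₂ mapV (λ { (G , H) → (relabel σ G , relabel σ H) }) (δ F)
      mult : ∀ F G → WellLabelled F → WellLabelled G → Disjoint (labels F) (labels G) →
             ext δ (F ◇ G) ≈₂ (δ F ◇₂ δ G)
      unit : δ ∙ ≈₂ ⟦ (∙ , ∙) ⟧
      rb : ∀ F → WellLabelled F → δ (B⁺ F) ≈₂ ext R² (δ F)
      gens : ∀ x → δ (gen x) ≈₂ (⟦ (gen x , ∙) ⟧ ++ ⟦ (∙ , gen x) ⟧)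

  record IsTwistedBialgebra (λ' : Carrier) (δ : Forest → V (Forest × Forest)) : Set (c ⊔ ℓ) where
    open Product λ'
    Δᵥ : V Forest → V (Forest × Forest)
    Δᵥ = ext δ
    field
      m-natural : ∀ (σ : ℕ → ℕ) → Injective _≡_ _≡_ σ → ∀ F G →
                  WellLabelled F → WellLabelled G → Disjoint (labels F) (labels G) →
                  (relabel σ F ◇ relabel σ G) ≈₁ mapV (relabel σ) (F ◇ G)
      m-assoc : ∀ F G H → WellLabelled F → WellLabelled G → WellLabelled H →
                Disjoint (labels F) (labels G) → Disjoint (labels F) (labels H) →
                Disjoint (labels G) (labels H) →
                ((F ◇ G) ◇ᵥ ⟦ H ⟧) ≈₁ (⟦ F ⟧ ◇ᵥ (G ◇ H))
      m-unitˡ : ∀ F → WellLabelled F → (∙ ◇ F) ≈₁ ⟦ F ⟧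
      m-unitʳ : ∀ F → WellLabelled F → (F ◇ ∙) ≈₁ ⟦ F ⟧
      Δ-graded : ∀ F → WellLabelled F → ∀ G H →
                 ¬ (labels G ++ labels H ↭ labels F) →
                 coeff _≟F²_ (δ F) (G , H) ≈ 0#
      Δ-natural : ∀ (σ : ℕ → ℕ) → Injective _≡_ _≡_ σ → ∀ F → WellLabelled F →
                  δ (relabel σ F) ≈₂ mapV (λ { (G , H) → (relabel σ G , relabel σ H) }) (δ F)
      ε-natural : ∀ (σ : ℕ → ℕ) → Injective _≡_ _≡_ σ → ∀ F → WellLabelled F →
                  ε (relabel σ F) ≈ ε F
      coassoc : ∀ F → WellLabelled F →
                ext (λ { (G , H) → mapV (λ { (A , B) → (A , B , H) }) (δ G) }) (δ F)
                ≈₃ ext (λ { (G , H) → mapV (λ { (A , B) → (G , A , B) }) (δ H) }) (δ F)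
      counitˡ : ∀ F → WellLabelled F →
                ext (λ { (G , H) → ε G ·ᵥ ⟦ H ⟧ }) (δ F) ≈₁ ⟦ F ⟧
      counitʳ : ∀ F → WellLabelled F →
                ext (λ { (G , H) → ε H ·ᵥ ⟦ G ⟧ }) (δ F) ≈₁ ⟦ F ⟧
      Δ-mult : ∀ F G → WellLabelled F → WellLabelled G → Disjoint (labels F) (labels G) →
               Δᵥ (F ◇ G) ≈₂ (δ F ◇₂ δ G)
      Δ-unit : δ ∙ ≈₂ ⟦ (∙ , ∙) ⟧
      ε-mult : ∀ F G → WellLabelled F → WellLabelled G → Disjoint (labels F) (labels G) →
               εᵥ (F ◇ G) ≈ ε F * ε G
      ε-unit : ε ∙ ≈ 1#

  Theorem3p11 : Carrier → Set (c ⊔ ℓ)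
  Theorem3p11 λ' =
    Σ (Forest → V (Forest × Forest)) (IsDelta λ')
    × (∀ δ → IsDelta λ' δ → IsTwistedBialgebra λ' δ)

{-# OPTIONS --termination-depth=3 #-}
-- Since T x F = T ◇ •x• ◇ F in ADF, a morphism of Rota–Baxter species with the
-- prescribed values on the generators must satisfy Δ(•) = •⊗•, Δ(B⁺F) = R⁽²⁾Δ(F) and
-- Δ(T x F) = Δ(T)(•x•⊗• + •⊗•x•)Δ(F); this recursion defines δ. It is multiplicative,
-- by induction on depth, because R⁽²⁾ = B⁺⊗id + ε•⊗B⁺ is a Rota–Baxter operator of
-- weight λ on ADF ⊗ ADF: both summands are, their mixed products reduce to B⁺⊗id, and
-- ε•⊗B⁺ kills the rest because the character ε vanishes on B⁺a ◇ b and a ◇ B⁺b.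
-- Associativity of ◇ is the same kind of induction, driven by the identity
-- B⁺a ◇ B⁺b = B⁺(B⁺a ◇ b + a ◇ B⁺b + λ a ◇ b).
-- The coalgebra axioms follow from freeness: (ε⊗id)Δ, (id⊗ε)Δ and id, and likewise
-- (Δ⊗id)Δ and (id⊗Δ)Δ, respect products, the Rota–Baxter operators and generators,
-- hence agree. Any other Δ with the defining properties agrees with δ by the same
-- induction, so the axioms hold for it as well.
module Submission where

open import Defs
open import Level using (Level; _⊔_)
open import Algebra.Bundles using (CommutativeRing; CommutativeMonoid)
open import Data.Nat using (ℕ; suc; _≤_; z≤n; s≤s)
open import Data.Nat.Properties using (≤-refl; ≤-trans; m≤n⇒m≤1+n)
open import Data.List using (List; []; _∷_; _++_; length)
import Data.List.Properties as LP
open import Data.List.Relation.Unary.Any using (here; there)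
open import Data.List.Relation.Unary.All as All using (All; []; _∷_)
import Data.List.Relation.Unary.All.Properties as AllP
open import Data.List.Relation.Unary.AllPairs using ([]; _∷_)
open import Data.List.Relation.Unary.Unique.Propositional using (Unique)
open import Data.List.Relation.Binary.Permutation.Propositional
  using (_↭_; ↭-refl; ↭-trans; ↭-reflexive; ↭-sym; ↭⇒↭ₛ)
import Data.List.Relation.Binary.Permutation.Propositional.Properties as PmP
import Data.List.Relation.Binary.Permutation.Setoid.Properties as PermutationSetoid
open import Data.List.Relation.Binary.Disjoint.Propositional using (Disjoint)
open import Data.Product using (_×_; _,_; proj₁; proj₂; map₂)
open import Data.Sum using (_⊎_; inj₁; inj₂)
open import Data.Empty using (⊥-elim)
open import Relation.Nullary using (¬_; yes; no)
open import Relation.Binary.Definitions using (DecidableEquality)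
import Relation.Binary.PropositionalEquality as P
open P using (_≡_)
open import Function using (_∘_)

module PermutationProperties = PermutationSetoid (P.setoid ℕ)

Unique-++⁻ˡ : ∀ (xs : List ℕ) {ys} → Unique (xs ++ ys) → Unique xs
Unique-++⁻ˡ [] u = []
Unique-++⁻ˡ (x ∷ xs) (x∉ ∷ u) = AllP.++⁻ˡ xs x∉ ∷ Unique-++⁻ˡ xs u

Unique-++⁻ʳ : ∀ (xs : List ℕ) {ys} → Unique (xs ++ ys) → Unique ys
Unique-++⁻ʳ [] u = u
Unique-++⁻ʳ (x ∷ xs) (_ ∷ u) = Unique-++⁻ʳ xs u

Unique-++⇒Disjoint : ∀ (xs : List ℕ) {ys} → Unique (xs ++ ys) → Disjoint xs ys
Unique-++⇒Disjoint (x ∷ xs) (x∉ ∷ u) (here P.refl , y∈ys) = All.lookup (AllP.++⁻ʳ xs x∉) y∈ys P.refl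
Unique-++⇒Disjoint (x ∷ xs) (_ ∷ u) (there y∈xs , y∈ys) = Unique-++⇒Disjoint xs u (y∈xs , y∈ys)

Unique-resp-↭ : {xs ys : List ℕ} → xs ↭ ys → Unique xs → Unique ys
Unique-resp-↭ p = PermutationProperties.Unique-resp-↭ (↭⇒↭ₛ p)

↭-interchange : (a b c d : List ℕ) → (a ++ b) ++ (c ++ d) ↭ (a ++ c) ++ (b ++ d)
↭-interchange a b c d =
  ↭-trans (↭-reflexive (LP.++-assoc a b (c ++ d)))
    (↭-trans (PmP.++⁺ˡ a (↭-trans (↭-reflexive (P.sym (LP.++-assoc b c d)))
                        (↭-trans (PmP.++⁺ʳ d (PmP.++-comm b c)) (↭-reflexive (LP.++-assoc c b d)))))
             (↭-reflexive (P.sym (LP.++-assoc a c (b ++ d)))))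

module WellLabelledGraft (t : Tree) (x : ℕ) (F : Forest) (wl : WellLabelled (t ⟨ x ⟩ F)) where
  wellLabelled-head : WellLabelled (last t)
  wellLabelled-head = Unique-++⁻ˡ (labelsT t) wl

  wellLabelled-leaf⟨⟩ : WellLabelled (leaf ⟨ x ⟩ F)
  wellLabelled-leaf⟨⟩ = Unique-++⁻ʳ (labelsT t) wl

  wellLabelled-tail : WellLabelled F
  wellLabelled-tail with wellLabelled-leaf⟨⟩
  ... | _ ∷ u = u

  disjoint-head : Disjoint (labels (last t)) (labels (leaf ⟨ x ⟩ F))
  disjoint-head = Unique-++⇒Disjoint (labelsT t) wl

  disjoint-gen : Disjoint (labels (gen x)) (labels F)
  disjoint-gen = Unique-++⇒Disjoint (x ∷ []) wellLabelled-leaf⟨⟩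

module Linear {c ℓ : Level} (K : CommutativeRing c ℓ) where
  open CommutativeRing K
  open ADF K
  open import Relation.Binary.Reasoning.Setoid setoid
  open import Algebra.Properties.CommutativeSemigroup +-commutativeSemigroup
    using (interchange) renaming (x∙yz≈y∙xz to x+[y+z]≈y+[x+z])
  open import Algebra.Properties.CommutativeSemigroup *-commutativeSemigroup
    using () renaming (x∙yz≈y∙xz to x*[y*z]≈y*[x*z])

  ev : {B : Set} → (B → Carrier) → V B → Carrier
  ev g [] = 0#
  ev g ((k , b) ∷ v) = k * g b + ev g v

  -- Formal sums are identified when every functional agrees on them. This is
  -- equivalent to coefficientwise equality (module Coefficients below) and
  -- reduces linearity arguments to ring identities.
  infix 4 _∼_
  record _∼_ {B : Set} (v w : V B) : Set (c ⊔ ℓ) where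
    constructor mk∼
    field ev-≈ : ∀ g → ev g v ≈ ev g w
  open _∼_ public

  module _ {B : Set} where
    ev-cong : ∀ {g h : B → Carrier} (v : V B) → (∀ b → g b ≈ h b) → ev g v ≈ ev h v
    ev-cong [] e = refl
    ev-cong ((k , b) ∷ v) e = +-cong (*-congˡ (e b)) (ev-cong v e)

    ev-++ : ∀ (g : B → Carrier) v w → ev g (v ++ w) ≈ ev g v + ev g w
    ev-++ g [] w = sym (+-identityˡ _)
    ev-++ g ((k , b) ∷ v) w = trans (+-congˡ (ev-++ g v w)) (sym (+-assoc _ _ _))

    ev-· : ∀ (g : B → Carrier) a v → ev g (a ·ᵥ v) ≈ a * ev g v
    ev-· g a [] = sym (zeroʳ a)
    ev-· g a ((k , b) ∷ v) = begin
      a * k * g b + ev g (a ·ᵥ v) ≈⟨ +-cong (*-assoc a k (g b)) (ev-· g a v) ⟩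
      a * (k * g b) + a * ev g v  ≈⟨ distribˡ a _ _ ⟨
      a * (k * g b + ev g v)      ∎

    ev-zero : ∀ (v : V B) → ev (λ _ → 0#) v ≈ 0#
    ev-zero [] = refl
    ev-zero ((k , b) ∷ v) = trans (+-cong (zeroʳ k) (ev-zero v)) (+-identityˡ 0#)

    ev-+ : ∀ (g h : B → Carrier) v → ev (λ b → g b + h b) v ≈ ev g v + ev h v
    ev-+ g h [] = sym (+-identityˡ 0#)
    ev-+ g h ((k , b) ∷ v) = trans (+-cong (distribˡ k (g b) (h b)) (ev-+ g h v)) (interchange _ _ _ _)

    ev-* : ∀ (g : B → Carrier) a v → ev (λ b → a * g b) v ≈ a * ev g v
    ev-* g a [] = sym (zeroʳ a)
    ev-* g a ((k , b) ∷ v) = trans (+-cong (x*[y*z]≈y*[x*z] k a (g b)) (ev-* g a v)) (sym (distribˡ a _ _))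

    ev-*ʳ : ∀ (g : B → Carrier) c v → ev (λ b → g b * c) v ≈ ev g v * c
    ev-*ʳ g c v = trans (ev-cong v (λ b → *-comm (g b) c)) (trans (ev-* g c v) (*-comm c _))

    ev-mapV : ∀ {C : Set} (g : C → Carrier) (f : B → C) v → ev g (mapV f v) ≡ ev (g ∘ f) v
    ev-mapV g f [] = P.refl
    ev-mapV g f ((k , b) ∷ v) = P.cong (k * g (f b) +_) (ev-mapV g f v)

    ev-⟦⟧ : ∀ (g : B → Carrier) b → ev g ⟦ b ⟧ ≈ g b
    ev-⟦⟧ g b = trans (+-identityʳ _) (*-identityˡ _)

  ev-ext : ∀ {B C : Set} (g : C → Carrier) (f : B → V C) v → ev g (ext f v) ≈ ev (λ b → ev g (f b)) v
  ev-ext g f [] = refl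
  ev-ext g f ((k , b) ∷ v) = begin
    ev g ((k ·ᵥ f b) ++ ext f v)                ≈⟨ ev-++ g (k ·ᵥ f b) (ext f v) ⟩
    ev g (k ·ᵥ f b) + ev g (ext f v)            ≈⟨ +-cong (ev-· g k (f b)) (ev-ext g f v) ⟩
    k * ev g (f b) + ev (λ b → ev g (f b)) v    ∎

  ev-swap : ∀ {B C : Set} (h : B → C → Carrier) (v : V B) (w : V C) →
            ev (λ b → ev (h b) w) v ≈ ev (λ c → ev (λ b → h b c) v) w
  ev-swap h [] w = sym (ev-zero w)
  ev-swap h ((k , b) ∷ v) w = begin
    k * ev (h b) w + ev (λ b → ev (h b) w) v
      ≈⟨ +-cong (sym (ev-* (h b) k w)) (ev-swap h v w) ⟩
    ev (λ c → k * h b c) w + ev (λ c → ev (λ b → h b c) v) w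
      ≈⟨ ev-+ _ _ w ⟨
    ev (λ c → k * h b c + ev (λ b → h b c) v) w ∎

  module _ {B : Set} where
    ∼-refl : {v : V B} → v ∼ v
    ∼-refl = mk∼ λ g → refl

    ∼-sym : {v w : V B} → v ∼ w → w ∼ v
    ∼-sym e = mk∼ λ g → sym (ev-≈ e g)

    ∼-trans : {u v w : V B} → u ∼ v → v ∼ w → u ∼ w
    ∼-trans e f = mk∼ λ g → trans (ev-≈ e g) (ev-≈ f g)

    ∼-reflexive : {v w : V B} → v ≡ w → v ∼ w
    ∼-reflexive P.refl = ∼-refl

  infixr 2 _∼⟨_⟩_ _∼⟨_⟨_ _∼≡⟨_⟩_
  infix 3 _∼∎
  _∼⟨_⟩_ : ∀ {B : Set} (u : V B) {v w : V B} → u ∼ v → v ∼ w → u ∼ w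
  u ∼⟨ e ⟩ f = ∼-trans e f

  _∼⟨_⟨_ : ∀ {B : Set} (u : V B) {v w : V B} → v ∼ u → v ∼ w → u ∼ w
  u ∼⟨ e ⟨ f = ∼-trans (∼-sym e) f

  _∼≡⟨_⟩_ : ∀ {B : Set} (u : V B) {v w : V B} → u ≡ v → v ∼ w → u ∼ w
  u ∼≡⟨ u≡v ⟩ v∼w = ∼-trans (∼-reflexive u≡v) v∼w

  _∼∎ : ∀ {B : Set} (u : V B) → u ∼ u
  u ∼∎ = ∼-refl

  module _ {B : Set} where
    ++-cong : {v v' w w' : V B} → v ∼ v' → w ∼ w' → v ++ w ∼ v' ++ w'
    ++-cong {v} {v'} {w} {w'} e f = mk∼ λ g →
      trans (ev-++ g v w) (trans (+-cong (ev-≈ e g) (ev-≈ f g)) (sym (ev-++ g v' w')))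

    ++-congˡ : (v : V B) {w w' : V B} → w ∼ w' → v ++ w ∼ v ++ w'
    ++-congˡ v = ++-cong (∼-refl {v = v})

    ++-congʳ : {v v' : V B} (w : V B) → v ∼ v' → v ++ w ∼ v' ++ w
    ++-congʳ w e = ++-cong e (∼-refl {v = w})

    ++-comm : (v w : V B) → v ++ w ∼ w ++ v
    ++-comm v w = mk∼ λ g → trans (ev-++ g v w) (trans (+-comm _ _) (sym (ev-++ g w v)))

    ++-assoc : (u v w : V B) → (u ++ v) ++ w ∼ u ++ (v ++ w)
    ++-assoc u v w = ∼-reflexive (LP.++-assoc u v w)

    ++-identityʳ : (v : V B) → v ++ [] ∼ v
    ++-identityʳ v = ∼-reflexive (LP.++-identityʳ v)

    ·-congˡ : ∀ a {v w : V B} → v ∼ w → a ·ᵥ v ∼ a ·ᵥ w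
    ·-congˡ a {v} {w} e = mk∼ λ g → trans (ev-· g a v) (trans (*-congˡ (ev-≈ e g)) (sym (ev-· g a w)))

    ·-congʳ : ∀ {a b} (v : V B) → a ≈ b → a ·ᵥ v ∼ b ·ᵥ v
    ·-congʳ {a} {b} v e = mk∼ λ g → trans (ev-· g a v) (trans (*-congʳ e) (sym (ev-· g b v)))

    ·-++ : ∀ a (v w : V B) → a ·ᵥ (v ++ w) ∼ (a ·ᵥ v) ++ (a ·ᵥ w)
    ·-++ a v w = ∼-reflexive (LP.map-++ _ v w)

    ·-· : ∀ a b (v : V B) → a ·ᵥ (b ·ᵥ v) ∼ (a * b) ·ᵥ v
    ·-· a b v = mk∼ λ g → begin
      ev g (a ·ᵥ (b ·ᵥ v)) ≈⟨ ev-· g a (b ·ᵥ v) ⟩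
      a * ev g (b ·ᵥ v)    ≈⟨ *-congˡ (ev-· g b v) ⟩
      a * (b * ev g v)     ≈⟨ *-assoc a b _ ⟨
      a * b * ev g v       ≈⟨ ev-· g (a * b) v ⟨
      ev g ((a * b) ·ᵥ v)  ∎

    ·-comm : ∀ a b (v : V B) → a ·ᵥ (b ·ᵥ v) ∼ b ·ᵥ (a ·ᵥ v)
    ·-comm a b v = ∼-trans (·-· a b v) (∼-trans (·-congʳ v (*-comm a b)) (∼-sym (·-· b a v)))

    ·-++-++· : ∀ a (u v : V B) b w → a ·ᵥ (u ++ (v ++ b ·ᵥ w)) ∼ a ·ᵥ u ++ (a ·ᵥ v ++ a ·ᵥ (b ·ᵥ w))
    ·-++-++· a u v b w = ∼-trans (·-++ a u _) (++-congˡ (a ·ᵥ u) (·-++ a v (b ·ᵥ w)))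

    1· : (v : V B) → 1# ·ᵥ v ∼ v
    1· v = mk∼ λ g → trans (ev-· g 1# v) (*-identityˡ _)

    0· : (v : V B) → 0# ·ᵥ v ∼ []
    0· v = mk∼ λ g → trans (ev-· g 0# v) (zeroˡ _)

    ≈0· : ∀ {a} (v : V B) → a ≈ 0# → a ·ᵥ v ∼ []
    ≈0· v e = ∼-trans (·-congʳ v e) (0· v)

  ++-commutativeMonoid : Set → CommutativeMonoid c (c ⊔ ℓ)
  ++-commutativeMonoid B = record
    { Carrier = V B ; _≈_ = _∼_ ; _∙_ = _++_ ; ε = []
    ; isCommutativeMonoid = record
      { isMonoid = record
        { isSemigroup = record
          { isMagma = record
            { isEquivalence = record { refl = ∼-refl ; sym = ∼-sym ; trans = ∼-trans }
            ; ∙-cong = ++-cong }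
          ; assoc = ++-assoc }
        ; identity = (λ v → ∼-refl) , ++-identityʳ }
      ; comm = ++-comm } }

  module ++-Solver (B : Set) where
    open import Algebra.Solver.CommutativeMonoid (++-commutativeMonoid B) public

  module _ {B C : Set} where
    ext-cong : (f : B → V C) {v w : V B} → v ∼ w → ext f v ∼ ext f w
    ext-cong f {v} {w} e = mk∼ λ g → trans (ev-ext g f v) (trans (ev-≈ e _) (sym (ev-ext g f w)))

    ext-cong-fun : {f f' : B → V C} (v : V B) → (∀ b → f b ∼ f' b) → ext f v ∼ ext f' v
    ext-cong-fun {f} {f'} v e = mk∼ λ g →
      trans (ev-ext g f v) (trans (ev-cong v (λ b → ev-≈ (e b) g)) (sym (ev-ext g f' v)))

    ext-⟦⟧ : (f : B → V C) (b : B) → ext f ⟦ b ⟧ ∼ f b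
    ext-⟦⟧ f b = mk∼ λ g → trans (ev-ext g f ⟦ b ⟧) (ev-⟦⟧ (λ b → ev g (f b)) b)

    ext-++ : (f : B → V C) (v w : V B) → ext f (v ++ w) ∼ ext f v ++ ext f w
    ext-++ f v w = ∼-reflexive (LP.concatMap-++ _ v w)

    ext-⟦⟧++⟦⟧ : (f : B → V C) (a b : B) → ext f (⟦ a ⟧ ++ ⟦ b ⟧) ∼ f a ++ f b
    ext-⟦⟧++⟦⟧ f a b = ∼-trans (ext-++ f ⟦ a ⟧ ⟦ b ⟧) (++-cong (ext-⟦⟧ f a) (ext-⟦⟧ f b))

    ext-· : (f : B → V C) → ∀ a (v : V B) → ext f (a ·ᵥ v) ∼ a ·ᵥ ext f v
    ext-· f a v = mk∼ λ g → begin
      ev g (ext f (a ·ᵥ v))            ≈⟨ ev-ext g f (a ·ᵥ v) ⟩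
      ev (λ b → ev g (f b)) (a ·ᵥ v)   ≈⟨ ev-· (λ b → ev g (f b)) a v ⟩
      a * ev (λ b → ev g (f b)) v      ≈⟨ *-congˡ (ev-ext g f v) ⟨
      a * ev g (ext f v)               ≈⟨ ev-· g a (ext f v) ⟨
      ev g (a ·ᵥ ext f v)              ∎

    ext-++-fun : (f f' : B → V C) (v : V B) → ext (λ b → f b ++ f' b) v ∼ ext f v ++ ext f' v
    ext-++-fun f f' v = mk∼ λ g → begin
      ev g (ext (λ b → f b ++ f' b) v)                    ≈⟨ ev-ext g (λ b → f b ++ f' b) v ⟩
      ev (λ b → ev g (f b ++ f' b)) v                     ≈⟨ ev-cong v (λ b → ev-++ g (f b) (f' b)) ⟩
      ev (λ b → ev g (f b) + ev g (f' b)) v               ≈⟨ ev-+ (λ b → ev g (f b)) (λ b → ev g (f' b)) v ⟩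
      ev (λ b → ev g (f b)) v + ev (λ b → ev g (f' b)) v  ≈⟨ +-cong (ev-ext g f v) (ev-ext g f' v) ⟨
      ev g (ext f v) + ev g (ext f' v)                    ≈⟨ ev-++ g (ext f v) (ext f' v) ⟨
      ev g (ext f v ++ ext f' v)                          ∎

    ext-·-fun : (f : B → V C) → ∀ a (v : V B) → ext (λ b → a ·ᵥ f b) v ∼ a ·ᵥ ext f v
    ext-·-fun f a v = mk∼ λ g → begin
      ev g (ext (λ b → a ·ᵥ f b) v)   ≈⟨ ev-ext g (λ b → a ·ᵥ f b) v ⟩
      ev (λ b → ev g (a ·ᵥ f b)) v    ≈⟨ ev-cong v (λ b → ev-· g a (f b)) ⟩
      ev (λ b → a * ev g (f b)) v     ≈⟨ ev-* (λ b → ev g (f b)) a v ⟩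
      a * ev (λ b → ev g (f b)) v     ≈⟨ *-congˡ (ev-ext g f v) ⟨
      a * ev g (ext f v)              ≈⟨ ev-· g a (ext f v) ⟨
      ev g (a ·ᵥ ext f v)             ∎

    ext-++-++·-fun : (f g h : B → V C) (a : Carrier) (v : V B) →
                     ext (λ b → f b ++ (g b ++ a ·ᵥ h b)) v ∼ ext f v ++ (ext g v ++ a ·ᵥ ext h v)
    ext-++-++·-fun f g h a v =
      ∼-trans (ext-++-fun f (λ b → g b ++ a ·ᵥ h b) v)
        (++-congˡ (ext f v) (∼-trans (ext-++-fun g (λ b → a ·ᵥ h b) v) (++-congˡ (ext g v) (ext-·-fun h a v))))

    ext-++-++· : (f : B → V C) (u v : V B) (a : Carrier) (w : V B) →
                 ext f (u ++ (v ++ a ·ᵥ w)) ∼ ext f u ++ (ext f v ++ a ·ᵥ ext f w)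
    ext-++-++· f u v a w =
      ∼-trans (ext-++ f u _) (++-congˡ (ext f u) (∼-trans (ext-++ f v _) (++-congˡ (ext f v) (ext-· f a w))))

    ext-scalar : (f : B → Carrier) (w : V C) (v : V B) → ext (λ b → f b ·ᵥ w) v ∼ ev f v ·ᵥ w
    ext-scalar f w v = mk∼ λ g → begin
      ev g (ext (λ b → f b ·ᵥ w) v)   ≈⟨ ev-ext g (λ b → f b ·ᵥ w) v ⟩
      ev (λ b → ev g (f b ·ᵥ w)) v    ≈⟨ ev-cong v (λ b → ev-· g (f b) w) ⟩
      ev (λ b → f b * ev g w) v       ≈⟨ ev-*ʳ f (ev g w) v ⟩
      ev f v * ev g w                 ≈⟨ ev-· g (ev f v) w ⟨
      ev g (ev f v ·ᵥ w)              ∎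

    mapV-as-ext : (h : B → C) (v : V B) → mapV h v ∼ ext (λ b → ⟦ h b ⟧) v
    mapV-as-ext h v = mk∼ λ g → begin
      ev g (mapV h v)                  ≡⟨ ev-mapV g h v ⟩
      ev (g ∘ h) v                     ≈⟨ ev-cong v (λ b → ev-⟦⟧ g (h b)) ⟨
      ev (λ b → ev g ⟦ h b ⟧) v        ≈⟨ ev-ext g (λ b → ⟦ h b ⟧) v ⟨
      ev g (ext (λ b → ⟦ h b ⟧) v)     ∎

    mapV-cong : (h : B → C) {v w : V B} → v ∼ w → mapV h v ∼ mapV h w
    mapV-cong h {v} {w} e = mk∼ λ g →
      P.subst₂ _≈_ (P.sym (ev-mapV g h v)) (P.sym (ev-mapV g h w)) (ev-≈ e (g ∘ h))

    mapV-++ : (f : B → C) (v w : V B) → mapV f (v ++ w) ≡ mapV f v ++ mapV f w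
    mapV-++ f = LP.map-++ (map₂ f)

    mapV-· : (f : B → C) → ∀ a (v : V B) → mapV f (a ·ᵥ v) ≡ a ·ᵥ mapV f v
    mapV-· f a [] = P.refl
    mapV-· f a ((k , b) ∷ v) = P.cong ((a * k , f b) ∷_) (mapV-· f a v)

  ext-⟦⟧-id : {B : Set} (v : V B) → ext ⟦_⟧ v ∼ v
  ext-⟦⟧-id v = mk∼ λ g → trans (ev-ext g ⟦_⟧ v) (ev-cong v (ev-⟦⟧ g))

  ext-assoc : {B C D : Set} (f : B → V C) (h : C → V D) (v : V B) →
              ext h (ext f v) ∼ ext (λ b → ext h (f b)) v
  ext-assoc f h v = mk∼ λ g → begin
    ev g (ext h (ext f v))                        ≈⟨ ev-ext g h (ext f v) ⟩
    ev (λ c → ev g (h c)) (ext f v)               ≈⟨ ev-ext (λ c → ev g (h c)) f v ⟩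
    ev (λ b → ev (λ c → ev g (h c)) (f b)) v      ≈⟨ ev-cong v (λ b → ev-ext g h (f b)) ⟨
    ev (λ b → ev g (ext h (f b))) v               ≈⟨ ev-ext g (λ b → ext h (f b)) v ⟨
    ev g (ext (λ b → ext h (f b)) v)              ∎

  ext-swap : {B C D : Set} (h : B → C → V D) (v : V B) (w : V C) →
             ext (λ b → ext (h b) w) v ∼ ext (λ c → ext (λ b → h b c) v) w
  ext-swap h v w = mk∼ λ g → begin
    ev g (ext (λ b → ext (h b) w) v)              ≈⟨ ev-ext g (λ b → ext (h b) w) v ⟩
    ev (λ b → ev g (ext (h b) w)) v               ≈⟨ ev-cong v (λ b → ev-ext g (h b) w) ⟩
    ev (λ b → ev (λ c → ev g (h b c)) w) v        ≈⟨ ev-swap (λ b c → ev g (h b c)) v w ⟩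
    ev (λ c → ev (λ b → ev g (h b c)) v) w        ≈⟨ ev-cong w (λ c → ev-ext g (λ b → h b c) v) ⟨
    ev (λ c → ev g (ext (λ b → h b c) v)) w       ≈⟨ ev-ext g (λ c → ext (λ b → h b c) v) w ⟨
    ev g (ext (λ c → ext (λ b → h b c) v) w)      ∎

  mapV-∘ : {B C D : Set} (f : B → C) (h : C → D) (v : V B) → mapV h (mapV f v) ≡ mapV (h ∘ f) v
  mapV-∘ f h v = P.sym (LP.map-∘ v)

  mapV-ext : {B C D : Set} (h : C → D) (f : B → V C) (v : V B) →
             mapV h (ext f v) ∼ ext (λ b → mapV h (f b)) v
  mapV-ext h f v =
    mapV h (ext f v)                         ∼⟨ mapV-as-ext h (ext f v) ⟩
    ext (λ c → ⟦ h c ⟧) (ext f v)            ∼⟨ ext-assoc f (λ c → ⟦ h c ⟧) v ⟩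
    ext (λ b → ext (λ c → ⟦ h c ⟧) (f b)) v  ∼⟨ ext-cong-fun v (λ b → ∼-sym (mapV-as-ext h (f b))) ⟩
    ext (λ b → mapV h (f b)) v               ∼∎

  ext-mapV : {B C D : Set} (h : B → C) (f : C → V D) (v : V B) → ext f (mapV h v) ∼ ext (f ∘ h) v
  ext-mapV h f v = mk∼ λ g → begin
    ev g (ext f (mapV h v))             ≈⟨ ev-ext g f (mapV h v) ⟩
    ev (λ c → ev g (f c)) (mapV h v)    ≡⟨ ev-mapV (λ c → ev g (f c)) h v ⟩
    ev (λ b → ev g (f (h b))) v         ≈⟨ ev-ext g (f ∘ h) v ⟨
    ev g (ext (f ∘ h) v)                ∎

  module _ {B C D : Set} (m : B → C → V D) where
    ext₂-cong : {v v' : V B} {w w' : V C} → v ∼ v' → w ∼ w' → ext₂ m v w ∼ ext₂ m v' w'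
    ext₂-cong {v} {v'} {w} {w'} e f =
      ∼-trans (ext-cong (λ b → ext (m b) w) e) (ext-cong-fun v' (λ b → ext-cong (m b) f))

    ext₂-extˡ : {A : Set} (f : A → V B) → ∀ v w → ext₂ m (ext f v) w ∼ ext (λ a → ext₂ m (f a) w) v
    ext₂-extˡ f v w = ext-assoc f (λ b → ext (m b) w) v

    ext₂-extʳ : {A : Set} (f : A → V C) → ∀ v w → ext₂ m v (ext f w) ∼ ext (λ a → ext₂ m v (f a)) w
    ext₂-extʳ f v w =
      ∼-trans (ext-cong-fun v (λ b → ext-assoc f (m b) w)) (ext-swap (λ b c → ext (m b) (f c)) v w)

    ext₂-ext : {A A' : Set} (f : A → V B) (h : A' → V C) (X : V A) (Y : V A') →
               ext₂ m (ext f X) (ext h Y) ∼ ext₂ (λ p q → ext₂ m (f p) (h q)) X Y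
    ext₂-ext f h X Y = ∼-trans (ext₂-extˡ f X (ext h Y)) (ext-cong-fun X (λ p → ext₂-extʳ h (f p) Y))

    ext₂-⟦⟧ˡ : ∀ b w → ext₂ m ⟦ b ⟧ w ∼ ext (m b) w
    ext₂-⟦⟧ˡ b w = ext-⟦⟧ (λ b → ext (m b) w) b

    ext₂-⟦⟧ʳ : ∀ v c → ext₂ m v ⟦ c ⟧ ∼ ext (λ b → m b c) v
    ext₂-⟦⟧ʳ v c = ext-cong-fun v (λ b → ext-⟦⟧ (m b) c)

    ext₂-⟦⟧⟦⟧ : ∀ b c → ext₂ m ⟦ b ⟧ ⟦ c ⟧ ∼ m b c
    ext₂-⟦⟧⟦⟧ b c = ∼-trans (ext₂-⟦⟧ˡ b ⟦ c ⟧) (ext-⟦⟧ (m b) c)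

    ext₂-mapV : {A A' : Set} (f : A → B) (h : A' → C) (X : V A) (Y : V A') →
                ext₂ m (mapV f X) (mapV h Y) ∼ ext₂ (λ p q → m (f p) (h q)) X Y
    ext₂-mapV f h X Y =
      ext₂ m (mapV f X) (mapV h Y)
        ∼⟨ ext₂-cong (mapV-as-ext f X) (mapV-as-ext h Y) ⟩
      ext₂ m (ext (λ p → ⟦ f p ⟧) X) (ext (λ q → ⟦ h q ⟧) Y)
        ∼⟨ ext₂-ext (λ p → ⟦ f p ⟧) (λ q → ⟦ h q ⟧) X Y ⟩
      ext₂ (λ p q → ext₂ m ⟦ f p ⟧ ⟦ h q ⟧) X Y
        ∼⟨ ext-cong-fun X (λ p → ext-cong-fun Y (λ q → ext₂-⟦⟧⟦⟧ (f p) (h q))) ⟩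
      ext₂ (λ p q → m (f p) (h q)) X Y ∼∎

    ext₂-++ˡ : ∀ v v' w → ext₂ m (v ++ v') w ∼ ext₂ m v w ++ ext₂ m v' w
    ext₂-++ˡ v v' w = ext-++ (λ b → ext (m b) w) v v'

    ext₂-++ʳ : ∀ v w w' → ext₂ m v (w ++ w') ∼ ext₂ m v w ++ ext₂ m v w'
    ext₂-++ʳ v w w' =
      ∼-trans (ext-cong-fun v (λ b → ext-++ (m b) w w')) (ext-++-fun (λ b → ext (m b) w) (λ b → ext (m b) w') v)

    ext₂-·ˡ : ∀ a v w → ext₂ m (a ·ᵥ v) w ∼ a ·ᵥ ext₂ m v w
    ext₂-·ˡ a v w = ext-· (λ b → ext (m b) w) a v

    ext₂-·ʳ : ∀ a v w → ext₂ m v (a ·ᵥ w) ∼ a ·ᵥ ext₂ m v w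
    ext₂-·ʳ a v w = ∼-trans (ext-cong-fun v (λ b → ext-· (m b) a w)) (ext-·-fun (λ b → ext (m b) w) a v)

    ext₂-++·ˡ : ∀ v a v' w → ext₂ m (v ++ a ·ᵥ v') w ∼ ext₂ m v w ++ a ·ᵥ ext₂ m v' w
    ext₂-++·ˡ v a v' w = ∼-trans (ext₂-++ˡ v (a ·ᵥ v') w) (++-congˡ (ext₂ m v w) (ext₂-·ˡ a v' w))

    ext₂-++·ʳ : ∀ v w a w' → ext₂ m v (w ++ a ·ᵥ w') ∼ ext₂ m v w ++ a ·ᵥ ext₂ m v w'
    ext₂-++·ʳ v w a w' = ∼-trans (ext₂-++ʳ v w (a ·ᵥ w')) (++-congˡ (ext₂ m v w) (ext₂-·ʳ a v w'))

  module _ {A A' C : Set} where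
    ext₂-cong-fun : {h h' : A → A' → V C} (X : V A) (Y : V A') →
                    (∀ p q → h p q ∼ h' p q) → ext₂ h X Y ∼ ext₂ h' X Y
    ext₂-cong-fun X Y e = ext-cong-fun X (λ p → ext-cong-fun Y (e p))

    ext₂-++-fun : (h h' : A → A' → V C) (X : V A) (Y : V A') →
                  ext₂ (λ p q → h p q ++ h' p q) X Y ∼ ext₂ h X Y ++ ext₂ h' X Y
    ext₂-++-fun h h' X Y = ∼-trans (ext-cong-fun X (λ p → ext-++-fun (h p) (h' p) Y))
                                   (ext-++-fun (λ p → ext (h p) Y) (λ p → ext (h' p) Y) X)

    ext₂-·-fun : ∀ a (h : A → A' → V C) (X : V A) (Y : V A') →
                 ext₂ (λ p q → a ·ᵥ h p q) X Y ∼ a ·ᵥ ext₂ h X Y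
    ext₂-·-fun a h X Y = ∼-trans (ext-cong-fun X (λ p → ext-·-fun (h p) a Y)) (ext-·-fun (λ p → ext (h p) Y) a X)

    ext-ext₂ : {E : Set} (g : C → V E) (h : A → A' → V C) (X : V A) (Y : V A') →
               ext g (ext₂ h X Y) ∼ ext₂ (λ p q → ext g (h p q)) X Y
    ext-ext₂ g h X Y = ∼-trans (ext-assoc (λ p → ext (h p) Y) g X) (ext-cong-fun X (λ p → ext-assoc (h p) g Y))

  ext₂-assoc : {B : Set} (m : B → B → V B) →
               (∀ p q r → ext (λ u → m u r) (m p q) ∼ ext (m p) (m q r)) →
               ∀ X Y Z → ext₂ m (ext₂ m X Y) Z ∼ ext₂ m X (ext₂ m Y Z)
  ext₂-assoc m assoc X Y Z =
    ext₂ m (ext₂ m X Y) Z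
      ∼⟨ ext-assoc (λ p → ext (m p) Y) (λ u → ext (m u) Z) X ⟩
    ext (λ p → ext (λ u → ext (m u) Z) (ext (m p) Y)) X
      ∼⟨ ext-cong-fun X (λ p → ext-assoc (m p) (λ u → ext (m u) Z) Y) ⟩
    ext (λ p → ext (λ q → ext (λ u → ext (m u) Z) (m p q)) Y) X
      ∼⟨ ext-cong-fun X (λ p → ext-cong-fun Y (λ q → ext-swap (λ u r → m u r) (m p q) Z)) ⟩
    ext (λ p → ext (λ q → ext (λ r → ext (λ u → m u r) (m p q)) Z) Y) X
      ∼⟨ ext-cong-fun X (λ p → ext-cong-fun Y (λ q → ext-cong-fun Z (λ r → assoc p q r))) ⟩
    ext (λ p → ext (λ q → ext (λ r → ext (m p) (m q r)) Z) Y) X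
      ∼⟨ ext-cong-fun X (λ p → ext-cong-fun Y (λ q → ∼-sym (ext-assoc (m q) (m p) Z))) ⟩
    ext (λ p → ext (λ q → ext (m p) (ext (m q) Z)) Y) X
      ∼⟨ ext-cong-fun X (λ p → ∼-sym (ext-assoc (λ q → ext (m q) Z) (m p) Y)) ⟩
    ext₂ m X (ext₂ m Y Z)
      ∼∎

  ext-multiplicative : {B C : Set} (m : B → B → V B) (m' : C → C → V C) (h : B → V C) →
                       (∀ p q → ext h (m p q) ∼ ext₂ m' (h p) (h q)) →
                       ∀ X Y → ext h (ext₂ m X Y) ∼ ext₂ m' (ext h X) (ext h Y)
  ext-multiplicative m m' h e X Y =
    ext h (ext₂ m X Y)                        ∼⟨ ext-ext₂ h m X Y ⟩
    ext₂ (λ p q → ext h (m p q)) X Y          ∼⟨ ext₂-cong-fun X Y e ⟩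
    ext₂ (λ p q → ext₂ m' (h p) (h q)) X Y    ∼⟨ ext₂-ext m' h h X Y ⟨
    ext₂ m' (ext h X) (ext h Y)               ∼∎

  module Coefficients {B : Set} (d : DecidableEquality B) where
    indicator : B → B → Carrier
    indicator b b' with d b' b
    ... | yes _ = 1#
    ... | no _ = 0#

    coeff≈ev-indicator : ∀ v b → coeff d v b ≈ ev (indicator b) v
    coeff≈ev-indicator [] b = refl
    coeff≈ev-indicator ((k , b') ∷ v) b with d b' b
    ... | yes _ = +-cong (sym (*-identityʳ k)) (coeff≈ev-indicator v b)
    ... | no _ = trans (coeff≈ev-indicator v b) (sym (trans (+-congʳ (zeroʳ k)) (+-identityˡ _)))

    ∼⇒≈ : {v w : V B} → v ∼ w → v ≈[ d ] w
    ∼⇒≈ {v} {w} e b =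
      trans (coeff≈ev-indicator v b) (trans (ev-≈ e (indicator b)) (sym (coeff≈ev-indicator w b)))

    remove : B → V B → V B
    remove b [] = []
    remove b ((k , b') ∷ v) with d b' b
    ... | yes _ = remove b v
    ... | no _ = (k , b') ∷ remove b v

    length-remove : ∀ b v → length (remove b v) ≤ length v
    length-remove b [] = z≤n
    length-remove b ((k , b') ∷ v) with d b' b
    ... | yes _ = m≤n⇒m≤1+n (length-remove b v)
    ... | no _ = s≤s (length-remove b v)

    length-remove-head : ∀ k b v → length (remove b ((k , b) ∷ v)) ≤ length v
    length-remove-head k b v with d b b
    ... | yes _ = length-remove b v
    ... | no b≢b = ⊥-elim (b≢b P.refl)

    ev-remove : ∀ g b v → ev g v ≈ coeff d v b * g b + ev g (remove b v)
    ev-remove g b [] = sym (trans (+-identityʳ _) (zeroˡ _))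
    ev-remove g b ((k , b') ∷ v) with d b' b
    ... | yes P.refl = begin
      k * g b + ev g v                                      ≈⟨ +-congˡ (ev-remove g b v) ⟩
      k * g b + (coeff d v b * g b + ev g (remove b v))     ≈⟨ +-assoc _ _ _ ⟨
      (k * g b + coeff d v b * g b) + ev g (remove b v)     ≈⟨ +-congʳ (distribʳ (g b) k _) ⟨
      (k + coeff d v b) * g b + ev g (remove b v)           ∎
    ... | no _ = begin
      k * g b' + ev g v                                     ≈⟨ +-congˡ (ev-remove g b v) ⟩
      k * g b' + (coeff d v b * g b + ev g (remove b v))    ≈⟨ x+[y+z]≈y+[x+z] _ _ _ ⟩
      coeff d v b * g b + (k * g b' + ev g (remove b v))    ∎

    coeff-remove-same : ∀ b v → coeff d (remove b v) b ≈ 0#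
    coeff-remove-same b [] = refl
    coeff-remove-same b ((k , b') ∷ v) with d b' b
    ... | yes _ = coeff-remove-same b v
    ... | no b'≢b with d b' b
    ...   | yes b'≡b = ⊥-elim (b'≢b b'≡b)
    ...   | no _ = coeff-remove-same b v

    coeff-remove-other : ∀ b v x → ¬ b ≡ x → coeff d (remove b v) x ≈ coeff d v x
    coeff-remove-other b [] x b≢x = refl
    coeff-remove-other b ((k , b') ∷ v) x b≢x with d b' b
    ... | yes P.refl with d b' x
    ...   | yes b≡x = ⊥-elim (b≢x b≡x)
    ...   | no _ = coeff-remove-other b v x b≢x
    coeff-remove-other b ((k , b') ∷ v) x b≢x | no _ with d b' x
    ...   | yes _ = +-congˡ (coeff-remove-other b v x b≢x)
    ...   | no _ = coeff-remove-other b v x b≢x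

    -- n is fuel bounding the length: remove b w is not a structural subterm of w.
    coeff-zero⇒ev-zero : ∀ n g (w : V B) → length w ≤ n → (∀ x → coeff d w x ≈ 0#) → ev g w ≈ 0#
    coeff-zero⇒ev-zero n g [] _ _ = refl
    coeff-zero⇒ev-zero (suc n) g ((k , b) ∷ w) (s≤s |w|≤n) w≈0 = begin
      ev g ((k , b) ∷ w)                                   ≈⟨ ev-remove g b ((k , b) ∷ w) ⟩
      coeff d ((k , b) ∷ w) b * g b + ev g (remove b w′)   ≈⟨ +-cong (*-congʳ (w≈0 b)) rest≈0 ⟩
      0# * g b + 0#                                        ≈⟨ +-identityʳ _ ⟩
      0# * g b                                             ≈⟨ zeroˡ _ ⟩
      0#                                                   ∎
      where
      w′ = (k , b) ∷ w
      remove≈0 : ∀ x → coeff d (remove b w′) x ≈ 0#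
      remove≈0 x with d b x
      ... | yes P.refl = coeff-remove-same b w′
      ... | no b≢x = trans (coeff-remove-other b w′ x b≢x) (w≈0 x)
      rest≈0 = coeff-zero⇒ev-zero n g (remove b w′) (≤-trans (length-remove-head k b w) |w|≤n) remove≈0

    coeff-move-head : ∀ k b v w x → coeff d ((k , b) ∷ v) x ≈ coeff d w x →
                      coeff d v x ≈ coeff d ((- k , b) ∷ w) x
    coeff-move-head k b v w x e with d b x
    ... | yes _ = begin
      coeff d v x               ≈⟨ +-identityˡ _ ⟨
      0# + coeff d v x          ≈⟨ +-congʳ (-‿inverseˡ k) ⟨
      (- k + k) + coeff d v x   ≈⟨ +-assoc _ _ _ ⟩
      - k + (k + coeff d v x)   ≈⟨ +-congˡ e ⟩
      - k + coeff d w x         ∎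
    ... | no _ = e

    ≈⇒ev-≈ : ∀ g (v w : V B) → v ≈[ d ] w → ev g v ≈ ev g w
    ≈⇒ev-≈ g [] w e = sym (coeff-zero⇒ev-zero (length w) g w ≤-refl (λ x → sym (e x)))
    ≈⇒ev-≈ g ((k , b) ∷ v) w e = begin
      k * g b + ev g v
        ≈⟨ +-congˡ (≈⇒ev-≈ g v ((- k , b) ∷ w) (λ x → coeff-move-head k b v w x (e x))) ⟩
      k * g b + (- k * g b + ev g w)
        ≈⟨ +-assoc _ _ _ ⟨
      (k * g b + - k * g b) + ev g w
        ≈⟨ +-congʳ (distribʳ (g b) k (- k)) ⟨
      (k + - k) * g b + ev g w
        ≈⟨ +-congʳ (*-congʳ (-‿inverseʳ k)) ⟩
      0# * g b + ev g w
        ≈⟨ +-congʳ (zeroˡ _) ⟩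
      0# + ev g w
        ≈⟨ +-identityˡ _ ⟩
      ev g w ∎

    ≈⇒∼ : ∀ v w → v ≈[ d ] w → v ∼ w
    ≈⇒∼ v w e = mk∼ λ g → ≈⇒ev-≈ g v w e

module RotaBaxter {c ℓ : Level} (K : CommutativeRing c ℓ) where
  open CommutativeRing K using (Carrier)
  open ADF K
  open Linear K

  module _ {B : Set} (m : B → B → V B) (λ' : Carrier) where
    IsRotaBaxter : (B → V B) → Set (c ⊔ ℓ)
    IsRotaBaxter S =
      ∀ p q → ext₂ m (S p) (S q) ∼ ext S (ext₂ m (S p) ⟦ q ⟧ ++ (ext₂ m ⟦ p ⟧ (S q) ++ λ' ·ᵥ m p q))

    rotaBaxter-ext : ∀ {S} → IsRotaBaxter S → ∀ X Y →
                     ext₂ m (ext S X) (ext S Y) ∼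
                     ext S (ext₂ m (ext S X) Y ++ (ext₂ m X (ext S Y) ++ λ' ·ᵥ ext₂ m X Y))
    rotaBaxter-ext {S} rb X Y =
      ext₂ m (ext S X) (ext S Y)                                  ∼⟨ ext₂-ext m S S X Y ⟩
      ext₂ (λ p q → ext₂ m (S p) (S q)) X Y                       ∼⟨ ext₂-cong-fun X Y rb ⟩
      ext₂ (λ p q → ext S (l p q ++ (r p q ++ λ' ·ᵥ m p q))) X Y  ∼⟨ ext-ext₂ S _ X Y ⟨
      ext S (ext₂ (λ p q → l p q ++ (r p q ++ λ' ·ᵥ m p q)) X Y)  ∼⟨ ext-cong S split ⟩
      ext S (ext₂ m (ext S X) Y ++ (ext₂ m X (ext S Y) ++ λ' ·ᵥ ext₂ m X Y))
        ∼∎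
      where
      l r : B → B → V B
      l p q = ext₂ m (S p) ⟦ q ⟧
      r p q = ext₂ m ⟦ p ⟧ (S q)
      l-sum : ext₂ l X Y ∼ ext₂ m (ext S X) Y
      l-sum = ∼-trans (∼-sym (ext₂-ext m S ⟦_⟧ X Y)) (ext₂-cong m (∼-refl {v = ext S X}) (ext-⟦⟧-id Y))
      r-sum : ext₂ r X Y ∼ ext₂ m X (ext S Y)
      r-sum = ∼-trans (∼-sym (ext₂-ext m ⟦_⟧ S X Y)) (ext₂-cong m (ext-⟦⟧-id X) (∼-refl {v = ext S Y}))
      split : ext₂ (λ p q → l p q ++ (r p q ++ λ' ·ᵥ m p q)) X Y ∼
              ext₂ m (ext S X) Y ++ (ext₂ m X (ext S Y) ++ λ' ·ᵥ ext₂ m X Y)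
      split = ∼-trans (ext₂-++-fun l _ X Y)
                (++-cong l-sum (∼-trans (ext₂-++-fun r _ X Y) (++-cong r-sum (ext₂-·-fun λ' m X Y))))

    rotaBaxter-++ : ∀ {S T} → IsRotaBaxter S → IsRotaBaxter T →
                    (∀ p q → ext₂ m (S p) (T q) ∼ ext S (ext₂ m ⟦ p ⟧ (T q))) →
                    (∀ p q → ext₂ m (T p) (S q) ∼ ext S (ext₂ m (T p) ⟦ q ⟧)) →
                    (∀ p q → ext T (ext₂ m (S p) ⟦ q ⟧) ∼ []) →
                    (∀ p q → ext T (ext₂ m ⟦ p ⟧ (S q)) ∼ []) →
                    IsRotaBaxter (λ b → S b ++ T b)
    rotaBaxter-++ {S} {T} rbS rbT ST TS T[Sp·q]≈0 T[p·Sq]≈0 p q =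
      ext₂ m (S p ++ T p) (S q ++ T q)
        ∼⟨ ∼-trans (ext₂-++ˡ m (S p) (T p) (S q ++ T q))
                   (++-cong (ext₂-++ʳ m (S p) (S q) (T q)) (ext₂-++ʳ m (T p) (S q) (T q))) ⟩
      (ext₂ m (S p) (S q) ++ ext₂ m (S p) (T q)) ++ (ext₂ m (T p) (S q) ++ ext₂ m (T p) (T q))
        ∼⟨ ++-cong (++-cong (rbS p q) (ST p q)) (++-cong (TS p q) (rbT p q)) ⟩
      (ext S (Sp·q ++ (p·Sq ++ λ' ·ᵥ m p q)) ++ ext S p·Tq) ++ (ext S Tp·q ++ ext T (Tp·q ++ (p·Tq ++ λ' ·ᵥ m p q)))
        ∼⟨ ++-cong (++-congʳ (ext S p·Tq) (ext-++-++· S Sp·q p·Sq λ' (m p q)))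
                   (++-congˡ (ext S Tp·q) (ext-++-++· T Tp·q p·Tq λ' (m p q))) ⟩
      ((ext S Sp·q ++ (ext S p·Sq ++ λ' ·ᵥ ext S (m p q))) ++ ext S p·Tq) ++
      (ext S Tp·q ++ (ext T Tp·q ++ (ext T p·Tq ++ λ' ·ᵥ ext T (m p q))))
        ∼⟨ reorder (ext S Sp·q) (ext S p·Sq) (λ' ·ᵥ ext S (m p q)) (ext S p·Tq) (ext S Tp·q)
                   (ext T Tp·q) (ext T p·Tq) (λ' ·ᵥ ext T (m p q)) ⟩
      ((ext S Sp·q ++ ext S Tp·q) ++ ((ext S p·Sq ++ ext S p·Tq) ++ λ' ·ᵥ ext S (m p q))) ++
      (([] ++ ext T Tp·q) ++ (([] ++ ext T p·Tq) ++ λ' ·ᵥ ext T (m p q)))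
        ∼⟨ ++-congˡ (expanded S) (++-cong (++-congʳ (ext T Tp·q) (T[Sp·q]≈0 p q))
                                           (++-congʳ (λ' ·ᵥ ext T (m p q)) (++-congʳ (ext T p·Tq) (T[p·Sq]≈0 p q)))) ⟨
      expanded S ++ expanded T
        ∼⟨ ++-cong (expand S) (expand T) ⟨
      ext S Z ++ ext T Z
        ∼⟨ ext-++-fun S T Z ⟨
      ext (λ b → S b ++ T b) Z
        ∼∎
      where
      Sp·q = ext₂ m (S p) ⟦ q ⟧
      Tp·q = ext₂ m (T p) ⟦ q ⟧
      p·Sq = ext₂ m ⟦ p ⟧ (S q)
      p·Tq = ext₂ m ⟦ p ⟧ (T q)
      Z = ext₂ m (S p ++ T p) ⟦ q ⟧ ++ (ext₂ m ⟦ p ⟧ (S q ++ T q) ++ λ' ·ᵥ m p q)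
      expanded : (B → V B) → V B
      expanded U = (ext U Sp·q ++ ext U Tp·q) ++ ((ext U p·Sq ++ ext U p·Tq) ++ λ' ·ᵥ ext U (m p q))
      expand : ∀ U → ext U Z ∼ expanded U
      expand U = ∼-trans (ext-++-++· U (ext₂ m (S p ++ T p) ⟦ q ⟧) (ext₂ m ⟦ p ⟧ (S q ++ T q)) λ' (m p q))
        (++-cong (∼-trans (ext-cong U (ext₂-++ˡ m (S p) (T p) ⟦ q ⟧)) (ext-++ U Sp·q Tp·q))
                 (++-congʳ (λ' ·ᵥ ext U (m p q))
                           (∼-trans (ext-cong U (ext₂-++ʳ m ⟦ p ⟧ (S q) (T q))) (ext-++ U p·Sq p·Tq))))
      open ++-Solver B
      reorder : ∀ a₁ a₂ a₃ a₄ a₅ b₁ b₂ b₃ →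
                ((a₁ ++ (a₂ ++ a₃)) ++ a₄) ++ (a₅ ++ (b₁ ++ (b₂ ++ b₃))) ∼
                ((a₁ ++ a₅) ++ ((a₂ ++ a₄) ++ a₃)) ++ (([] ++ b₁) ++ (([] ++ b₂) ++ b₃))
      reorder = solve 8 (λ a₁ a₂ a₃ a₄ a₅ b₁ b₂ b₃ →
        ((a₁ ⊕ (a₂ ⊕ a₃)) ⊕ a₄) ⊕ (a₅ ⊕ (b₁ ⊕ (b₂ ⊕ b₃))) ⊜
        ((a₁ ⊕ a₅) ⊕ ((a₂ ⊕ a₄) ⊕ a₃)) ⊕ ((id ⊕ b₁) ⊕ ((id ⊕ b₂) ⊕ b₃))) ∼-refl

module ProductLaws {c ℓ : Level} (K : CommutativeRing c ℓ) (λ' : CommutativeRing.Carrier K) where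
  open ADF K
  open Product λ'
  open Linear K

  ff-last : ∀ F t → F ◇ last t ≡ ft F t
  ff-last (last s) t = P.refl
  ff-last (s ⟨ x ⟩ F) t = P.cong (mapV (s ⟨ x ⟩_)) (ff-last F t)

  ◇ₜ-identityʳ : ∀ s → s ◇ₜ leaf ≡ ⟦ s ⟧
  ◇ₜ-identityʳ leaf = P.refl
  ◇ₜ-identityʳ (node A) = P.refl

  ft-leaf : ∀ F → ft F leaf ≡ ⟦ F ⟧
  ft-leaf (last s) = P.cong (mapV last) (◇ₜ-identityʳ s)
  ft-leaf (s ⟨ x ⟩ F) = P.cong (mapV (s ⟨ x ⟩_)) (ft-leaf F)

  ◇-identityˡ : ∀ F → ∙ ◇ F ≡ ⟦ F ⟧
  ◇-identityˡ (last t) = P.refl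
  ◇-identityˡ (t ⟨ x ⟩ F) = P.refl

  ◇-identityʳ : ∀ F → F ◇ ∙ ≡ ⟦ F ⟧
  ◇-identityʳ F = P.trans (ff-last F leaf) (ft-leaf F)

  gen-◇ : ∀ x F → gen x ◇ F ≡ ⟦ leaf ⟨ x ⟩ F ⟧
  gen-◇ x F = P.cong (mapV (leaf ⟨ x ⟩_)) (◇-identityˡ F)

  last-◇-leaf⟨⟩ : ∀ t x F → last t ◇ (leaf ⟨ x ⟩ F) ≡ ⟦ t ⟨ x ⟩ F ⟧
  last-◇-leaf⟨⟩ t x F = P.cong (mapV (_⟨ x ⟩ F)) (◇ₜ-identityʳ t)

  ρ : Forest → Forest → V Forest
  ρ a b = B⁺ a ◇ b ++ (a ◇ B⁺ b ++ λ' ·ᵥ (a ◇ b))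

  mapV-ρ : {C : Set} (h : Forest → C) → ∀ a b →
           mapV h (ρ a b) ≡ mapV h (B⁺ a ◇ b) ++ (mapV h (a ◇ B⁺ b) ++ λ' ·ᵥ mapV h (a ◇ b))
  mapV-ρ h a b = P.trans (mapV-++ h (B⁺ a ◇ b) _) (P.cong (mapV h (B⁺ a ◇ b) ++_)
    (P.trans (mapV-++ h (a ◇ B⁺ b) _) (P.cong (mapV h (a ◇ B⁺ b) ++_) (mapV-· h λ' (a ◇ b)))))

  node-◇ₜ-node≡ : ∀ a b → node a ◇ₜ node b ≡ mapV node (ρ a b)
  node-◇ₜ-node≡ a b = P.sym (P.trans (mapV-ρ node a b)
    (P.cong (λ u → mapV node (B⁺ a ◇ b) ++ (mapV node u ++ λ' ·ᵥ mapV node (a ◇ b))) (ff-last a (node b))))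

  node-◇ₜ-node : ∀ a b → node a ◇ₜ node b ∼ mapV node (ρ a b)
  node-◇ₜ-node a b = ∼-reflexive (node-◇ₜ-node≡ a b)

  B⁺-◇-B⁺ : ∀ a b → B⁺ a ◇ B⁺ b ≡ mapV B⁺ (ρ a b)
  B⁺-◇-B⁺ a b = P.trans (P.cong (mapV last) (node-◇ₜ-node≡ a b)) (mapV-∘ node last (ρ a b))

  prod₃ˡ prod₃ʳ : Forest → Forest → Forest → V Forest
  prod₃ˡ F G H = ext (_◇ H) (F ◇ G)
  prod₃ʳ F G H = ext (F ◇_) (G ◇ H)

  ext-ρ : (h : Forest → V Forest) → ∀ a b →
          ext h (ρ a b) ∼ ext h (B⁺ a ◇ b) ++ (ext h (a ◇ B⁺ b) ++ λ' ·ᵥ ext h (a ◇ b))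
  ext-ρ h a b = ext-++-++· h (B⁺ a ◇ b) (a ◇ B⁺ b) λ' (a ◇ b)

  -- Expanding (B⁺a ◇ B⁺b) ◇ B⁺c, or B⁺a ◇ (B⁺b ◇ B⁺c), twice by the Rota–Baxter
  -- relation gives these seven terms, bracketed by T.
  ρ-terms : (Forest → Forest → Forest → V Forest) → Forest → Forest → Forest → V Forest
  ρ-terms T a b c =
    (T (B⁺ a) (B⁺ b) c ++ (T (B⁺ a) b (B⁺ c) ++ λ' ·ᵥ T (B⁺ a) b c)) ++
    (T a (B⁺ b) (B⁺ c) ++ (λ' ·ᵥ T a (B⁺ b) c ++ (λ' ·ᵥ T a b (B⁺ c) ++ λ' ·ᵥ (λ' ·ᵥ T a b c))))

  ρ-ρˡ : ∀ a b c → ext (λ A → ρ A c) (ρ a b) ∼ ρ-terms prod₃ˡ a b c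
  ρ-ρˡ a b c =
    ext (λ A → ρ A c) (ρ a b)
      ∼⟨ ext-++-++·-fun (λ A → B⁺ A ◇ c) (_◇ B⁺ c) (_◇ c) λ' (ρ a b) ⟩
    ext (λ A → B⁺ A ◇ c) (ρ a b) ++ (ext (_◇ B⁺ c) (ρ a b) ++ λ' ·ᵥ ext (_◇ c) (ρ a b))
      ∼⟨ ++-cong outer (++-cong (ext-ρ (_◇ B⁺ c) a b) (·-congˡ λ' (ext-ρ (_◇ c) a b))) ⟩
    t₁ ++ ((t₂ ++ (t₃ ++ λ' ·ᵥ t₄)) ++ λ' ·ᵥ (t₅ ++ (t₆ ++ λ' ·ᵥ t₇)))
      ∼⟨ ++-congˡ t₁ (++-congˡ (t₂ ++ (t₃ ++ λ' ·ᵥ t₄)) (·-++-++· λ' t₅ t₆ λ' t₇)) ⟩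
    t₁ ++ ((t₂ ++ (t₃ ++ λ' ·ᵥ t₄)) ++ (λ' ·ᵥ t₅ ++ (λ' ·ᵥ t₆ ++ λ' ·ᵥ (λ' ·ᵥ t₇))))
      ∼⟨ reorder t₁ t₂ t₃ (λ' ·ᵥ t₄) (λ' ·ᵥ t₅) (λ' ·ᵥ t₆) (λ' ·ᵥ (λ' ·ᵥ t₇)) ⟩
    ρ-terms prod₃ˡ a b c
      ∼∎
    where
    t₁ = prod₃ˡ (B⁺ a) (B⁺ b) c
    t₂ = prod₃ˡ (B⁺ a) b (B⁺ c)
    t₃ = prod₃ˡ a (B⁺ b) (B⁺ c)
    t₄ = prod₃ˡ a b (B⁺ c)
    t₅ = prod₃ˡ (B⁺ a) b c
    t₆ = prod₃ˡ a (B⁺ b) c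
    t₇ = prod₃ˡ a b c
    outer : ext (λ A → B⁺ A ◇ c) (ρ a b) ∼ t₁
    outer = ∼-trans (∼-sym (ext-mapV B⁺ (_◇ c) (ρ a b))) (ext-cong (_◇ c) (∼-reflexive (P.sym (B⁺-◇-B⁺ a b))))
    open ++-Solver Forest
    reorder : ∀ x₁ x₂ x₃ x₄ x₅ x₆ x₇ →
              x₁ ++ ((x₂ ++ (x₃ ++ x₄)) ++ (x₅ ++ (x₆ ++ x₇))) ∼
              (x₁ ++ (x₂ ++ x₅)) ++ (x₃ ++ (x₆ ++ (x₄ ++ x₇)))
    reorder = solve 7 (λ x₁ x₂ x₃ x₄ x₅ x₆ x₇ →
      x₁ ⊕ ((x₂ ⊕ (x₃ ⊕ x₄)) ⊕ (x₅ ⊕ (x₆ ⊕ x₇))) ⊜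
      (x₁ ⊕ (x₂ ⊕ x₅)) ⊕ (x₃ ⊕ (x₆ ⊕ (x₄ ⊕ x₇)))) ∼-refl

  ρ-ρʳ : ∀ a b c → ext (ρ a) (ρ b c) ∼ ρ-terms prod₃ʳ a b c
  ρ-ρʳ a b c =
    ext (ρ a) (ρ b c)
      ∼⟨ ext-++-++·-fun (B⁺ a ◇_) (λ A → a ◇ B⁺ A) (a ◇_) λ' (ρ b c) ⟩
    ext (B⁺ a ◇_) (ρ b c) ++ (ext (λ A → a ◇ B⁺ A) (ρ b c) ++ λ' ·ᵥ ext (a ◇_) (ρ b c))
      ∼⟨ ++-cong (ext-ρ (B⁺ a ◇_) b c) (++-cong inner (·-congˡ λ' (ext-ρ (a ◇_) b c))) ⟩
    (t₁ ++ (t₂ ++ λ' ·ᵥ t₃)) ++ (t₄ ++ λ' ·ᵥ (t₅ ++ (t₆ ++ λ' ·ᵥ t₇)))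
      ∼⟨ ++-congˡ (t₁ ++ (t₂ ++ λ' ·ᵥ t₃)) (++-congˡ t₄ (·-++-++· λ' t₅ t₆ λ' t₇)) ⟩
    ρ-terms prod₃ʳ a b c
      ∼∎
    where
    t₁ = prod₃ʳ (B⁺ a) (B⁺ b) c
    t₂ = prod₃ʳ (B⁺ a) b (B⁺ c)
    t₃ = prod₃ʳ (B⁺ a) b c
    t₄ = prod₃ʳ a (B⁺ b) (B⁺ c)
    t₅ = prod₃ʳ a (B⁺ b) c
    t₆ = prod₃ʳ a b (B⁺ c)
    t₇ = prod₃ʳ a b c
    inner : ext (λ A → a ◇ B⁺ A) (ρ b c) ∼ t₄
    inner = ∼-trans (∼-sym (ext-mapV B⁺ (a ◇_) (ρ b c))) (ext-cong (a ◇_) (∼-reflexive (P.sym (B⁺-◇-B⁺ b c))))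

  mapV-◇ₜ-assoc : (h : Tree → Forest) (s t u : Tree) →
                  ext (_◇ₜ u) (s ◇ₜ t) ∼ ext (s ◇ₜ_) (t ◇ₜ u) →
                  ext (λ w → mapV h (w ◇ₜ u)) (s ◇ₜ t) ∼ ext (λ w → mapV h (s ◇ₜ w)) (t ◇ₜ u)
  mapV-◇ₜ-assoc h s t u e =
    ext (λ w → mapV h (w ◇ₜ u)) (s ◇ₜ t)   ∼⟨ mapV-ext h (_◇ₜ u) (s ◇ₜ t) ⟨
    mapV h (ext (_◇ₜ u) (s ◇ₜ t))          ∼⟨ mapV-cong h e ⟩
    mapV h (ext (s ◇ₜ_) (t ◇ₜ u))          ∼⟨ mapV-ext h (s ◇ₜ_) (t ◇ₜ u) ⟩
    ext (λ w → mapV h (s ◇ₜ w)) (t ◇ₜ u)   ∼∎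

  -- Recursion on depth: the case of three nodes calls ◇-assoc on forests of
  -- smaller total depth, which needs --termination-depth=3 to be seen.
  mutual
    ◇ₜ-assoc : ∀ s t u → ext (_◇ₜ u) (s ◇ₜ t) ∼ ext (s ◇ₜ_) (t ◇ₜ u)
    ◇ₜ-assoc leaf t u = ∼-trans (ext-⟦⟧ (_◇ₜ u) t) (∼-sym (ext-⟦⟧-id (t ◇ₜ u)))
    ◇ₜ-assoc (node a) leaf u = ∼-trans (ext-⟦⟧ (_◇ₜ u) (node a)) (∼-sym (ext-⟦⟧ (node a ◇ₜ_) u))
    ◇ₜ-assoc (node a) (node b) leaf =
      ∼-trans (ext-cong-fun (node a ◇ₜ node b) (λ w → ∼-reflexive (◇ₜ-identityʳ w)))
        (∼-trans (ext-⟦⟧-id _) (∼-sym (ext-⟦⟧ (node a ◇ₜ_) (node b))))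
    ◇ₜ-assoc (node a) (node b) (node c) =
      ext (_◇ₜ node c) (node a ◇ₜ node b)      ∼⟨ ext-cong (_◇ₜ node c) (node-◇ₜ-node a b) ⟩
      ext (_◇ₜ node c) (mapV node (ρ a b))     ∼⟨ ext-mapV node (_◇ₜ node c) (ρ a b) ⟩
      ext (λ A → node A ◇ₜ node c) (ρ a b)     ∼⟨ ext-cong-fun (ρ a b) (λ A → node-◇ₜ-node A c) ⟩
      ext (λ A → mapV node (ρ A c)) (ρ a b)    ∼⟨ mapV-ext node (λ A → ρ A c) (ρ a b) ⟨
      mapV node (ext (λ A → ρ A c) (ρ a b))    ∼⟨ mapV-cong node (ρ-assoc a b c) ⟩
      mapV node (ext (ρ a) (ρ b c))            ∼⟨ mapV-ext node (ρ a) (ρ b c) ⟩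
      ext (λ A → mapV node (ρ a A)) (ρ b c)    ∼⟨ ext-cong-fun (ρ b c) (λ A → node-◇ₜ-node a A) ⟨
      ext (λ A → node a ◇ₜ node A) (ρ b c)     ∼⟨ ext-mapV node (node a ◇ₜ_) (ρ b c) ⟨
      ext (node a ◇ₜ_) (mapV node (ρ b c))     ∼⟨ ext-cong (node a ◇ₜ_) (node-◇ₜ-node b c) ⟨
      ext (node a ◇ₜ_) (node b ◇ₜ node c)      ∼∎

    ρ-assoc : ∀ a b c → ext (λ A → ρ A c) (ρ a b) ∼ ext (ρ a) (ρ b c)
    ρ-assoc a b c =
      ext (λ A → ρ A c) (ρ a b)   ∼⟨ ρ-ρˡ a b c ⟩
      ρ-terms prod₃ˡ a b c
        ∼⟨ ++-cong (++-cong (◇-assoc (last (node a)) (last (node b)) c)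
                            (++-cong (◇-assoc (last (node a)) b (last (node c)))
                                     (·-congˡ λ' (◇-assoc (last (node a)) b c))))
                   (++-cong (◇-assoc a (last (node b)) (last (node c)))
                            (++-cong (·-congˡ λ' (◇-assoc a (last (node b)) c))
                                     (++-cong (·-congˡ λ' (◇-assoc a b (last (node c))))
                                              (·-congˡ λ' (·-congˡ λ' (◇-assoc a b c)))))) ⟩
      ρ-terms prod₃ʳ a b c        ∼⟨ ρ-ρʳ a b c ⟨
      ext (ρ a) (ρ b c)           ∼∎

    ◇-assoc : ∀ F G H → prod₃ˡ F G H ∼ prod₃ʳ F G H
    ◇-assoc (s ⟨ x ⟩ F) G H =
      ext (_◇ H) (mapV (s ⟨ x ⟩_) (F ◇ G))          ∼⟨ ext-mapV (s ⟨ x ⟩_) (_◇ H) (F ◇ G) ⟩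
      ext (λ u → mapV (s ⟨ x ⟩_) (u ◇ H)) (F ◇ G)   ∼⟨ mapV-ext (s ⟨ x ⟩_) (_◇ H) (F ◇ G) ⟨
      mapV (s ⟨ x ⟩_) (prod₃ˡ F G H)                ∼⟨ mapV-cong (s ⟨ x ⟩_) (◇-assoc F G H) ⟩
      mapV (s ⟨ x ⟩_) (prod₃ʳ F G H)                ∼⟨ mapV-ext (s ⟨ x ⟩_) (F ◇_) (G ◇ H) ⟩
      ext (λ u → mapV (s ⟨ x ⟩_) (F ◇ u)) (G ◇ H)   ∼∎
    ◇-assoc (last s) (t ⟨ y ⟩ G) H =
      ext (_◇ H) (mapV (_⟨ y ⟩ G) (s ◇ₜ t))
        ∼⟨ ext-mapV (_⟨ y ⟩ G) (_◇ H) (s ◇ₜ t) ⟩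
      ext (λ w → mapV (w ⟨ y ⟩_) (G ◇ H)) (s ◇ₜ t)
        ∼⟨ ext-cong-fun (s ◇ₜ t) (λ w → mapV-as-ext (w ⟨ y ⟩_) (G ◇ H)) ⟩
      ext (λ w → ext (λ u → ⟦ w ⟨ y ⟩ u ⟧) (G ◇ H)) (s ◇ₜ t)
        ∼⟨ ext-swap (λ w u → ⟦ w ⟨ y ⟩ u ⟧) (s ◇ₜ t) (G ◇ H) ⟩
      ext (λ u → ext (λ w → ⟦ w ⟨ y ⟩ u ⟧) (s ◇ₜ t)) (G ◇ H)
        ∼⟨ ext-cong-fun (G ◇ H) (λ u → mapV-as-ext (_⟨ y ⟩ u) (s ◇ₜ t)) ⟨
      ext (λ u → mapV (_⟨ y ⟩ u) (s ◇ₜ t)) (G ◇ H)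
        ∼⟨ ext-mapV (t ⟨ y ⟩_) (last s ◇_) (G ◇ H) ⟨
      ext (last s ◇_) (mapV (t ⟨ y ⟩_) (G ◇ H)) ∼∎
    ◇-assoc (last s) (last t) (last u) =
      ext (_◇ last u) (mapV last (s ◇ₜ t))         ∼⟨ ext-mapV last (_◇ last u) (s ◇ₜ t) ⟩
      ext (λ w → mapV last (w ◇ₜ u)) (s ◇ₜ t)      ∼⟨ mapV-◇ₜ-assoc last s t u (◇ₜ-assoc s t u) ⟩
      ext (λ w → mapV last (s ◇ₜ w)) (t ◇ₜ u)      ∼⟨ ext-mapV last (last s ◇_) (t ◇ₜ u) ⟨
      ext (last s ◇_) (mapV last (t ◇ₜ u))         ∼∎
    ◇-assoc (last s) (last t) (u ⟨ z ⟩ Q) =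
      ext (_◇ (u ⟨ z ⟩ Q)) (mapV last (s ◇ₜ t))
        ∼⟨ ext-mapV last (_◇ (u ⟨ z ⟩ Q)) (s ◇ₜ t) ⟩
      ext (λ w → mapV (_⟨ z ⟩ Q) (w ◇ₜ u)) (s ◇ₜ t)
        ∼⟨ mapV-◇ₜ-assoc (_⟨ z ⟩ Q) s t u (◇ₜ-assoc s t u) ⟩
      ext (λ w → mapV (_⟨ z ⟩ Q) (s ◇ₜ w)) (t ◇ₜ u)
        ∼⟨ ext-mapV (_⟨ z ⟩ Q) (last s ◇_) (t ◇ₜ u) ⟨
      ext (last s ◇_) (mapV (_⟨ z ⟩ Q) (t ◇ₜ u)) ∼∎

  ◇-assoc-⟦⟧ : ∀ F G H → (F ◇ G) ◇ᵥ ⟦ H ⟧ ∼ ⟦ F ⟧ ◇ᵥ (G ◇ H)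
  ◇-assoc-⟦⟧ F G H =
    ∼-trans (ext₂-⟦⟧ʳ _◇_ (F ◇ G) H) (∼-trans (◇-assoc F G H) (∼-sym (ext₂-⟦⟧ˡ _◇_ F (G ◇ H))))

module TensorSquare {c ℓ : Level} (K : CommutativeRing c ℓ) (λ' : CommutativeRing.Carrier K) where
  open ADF K
  open Product λ'
  open Linear K
  open ProductLaws K λ'

  Forest² = Forest × Forest

  pair : Forest → Forest → V Forest²
  pair F G = ⟦ (F , G) ⟧

  infixr 6 _⊗_
  _⊗_ : V Forest → V Forest → V Forest²
  v ⊗ w = ext₂ pair v w

  m₂ : Forest² → Forest² → V Forest²
  m₂ p q = (proj₁ p ◇ proj₁ q) ⊗ (proj₂ p ◇ proj₂ q)

  ⊗-cong : {v v' w w' : V Forest} → v ∼ v' → w ∼ w' → v ⊗ w ∼ v' ⊗ w'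
  ⊗-cong = ext₂-cong pair

  ⊗⟦⟧ : ∀ a b → ⟦ a ⟧ ⊗ ⟦ b ⟧ ∼ ⟦ (a , b) ⟧
  ⊗⟦⟧ = ext₂-⟦⟧⟦⟧ pair

  ext-⊗ : {C : Set} (h : Forest² → V C) (v w : V Forest) → ext h (v ⊗ w) ∼ ext (λ a → ext (λ b → h (a , b)) w) v
  ext-⊗ h v w =
    ext h (ext (λ a → ext (pair a) w) v)
      ∼⟨ ext-assoc (λ a → ext (pair a) w) h v ⟩
    ext (λ a → ext h (ext (pair a) w)) v
      ∼⟨ ext-cong-fun v (λ a → ext-assoc (pair a) h w) ⟩
    ext (λ a → ext (λ b → ext h ⟦ (a , b) ⟧) w) v
      ∼⟨ ext-cong-fun v (λ a → ext-cong-fun w (λ b → ext-⟦⟧ h (a , b))) ⟩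
    ext (λ a → ext (λ b → h (a , b)) w) v ∼∎

  ⊗-++-++·ˡ : ∀ x y z (w : V Forest) → (x ++ (y ++ λ' ·ᵥ z)) ⊗ w ∼ x ⊗ w ++ (y ⊗ w ++ λ' ·ᵥ (z ⊗ w))
  ⊗-++-++·ˡ x y z w = ∼-trans (ext₂-++ˡ pair x _ w) (++-congˡ (x ⊗ w) (ext₂-++·ˡ pair y λ' z w))

  ⊗-++-++·ʳ : ∀ (w : V Forest) x y z → w ⊗ (x ++ (y ++ λ' ·ᵥ z)) ∼ w ⊗ x ++ (w ⊗ y ++ λ' ·ᵥ (w ⊗ z))
  ⊗-++-++·ʳ w x y z = ∼-trans (ext₂-++ʳ pair w x _) (++-congˡ (w ⊗ x) (ext₂-++·ʳ pair w y λ' z))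

  m₂-assoc : ∀ p q r → ext (λ u → m₂ u r) (m₂ p q) ∼ ext (m₂ p) (m₂ q r)
  m₂-assoc (p₁ , p₂) (q₁ , q₂) (r₁ , r₂) =
    ext (λ u → m₂ u (r₁ , r₂)) ((p₁ ◇ q₁) ⊗ (p₂ ◇ q₂))
      ∼⟨ ext-⊗ (λ u → m₂ u (r₁ , r₂)) (p₁ ◇ q₁) (p₂ ◇ q₂) ⟩
    ext (λ a → ext (λ b → (a ◇ r₁) ⊗ (b ◇ r₂)) (p₂ ◇ q₂)) (p₁ ◇ q₁)
      ∼⟨ ext₂-ext pair (_◇ r₁) (_◇ r₂) (p₁ ◇ q₁) (p₂ ◇ q₂) ⟨
    prod₃ˡ p₁ q₁ r₁ ⊗ prod₃ˡ p₂ q₂ r₂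
      ∼⟨ ⊗-cong (◇-assoc p₁ q₁ r₁) (◇-assoc p₂ q₂ r₂) ⟩
    prod₃ʳ p₁ q₁ r₁ ⊗ prod₃ʳ p₂ q₂ r₂
      ∼⟨ ext₂-ext pair (p₁ ◇_) (p₂ ◇_) (q₁ ◇ r₁) (q₂ ◇ r₂) ⟩
    ext (λ a → ext (λ b → (p₁ ◇ a) ⊗ (p₂ ◇ b)) (q₂ ◇ r₂)) (q₁ ◇ r₁)
      ∼⟨ ext-⊗ (m₂ (p₁ , p₂)) (q₁ ◇ r₁) (q₂ ◇ r₂) ⟨
    ext (m₂ (p₁ , p₂)) ((q₁ ◇ r₁) ⊗ (q₂ ◇ r₂))              ∼∎

  ◇₂-assoc : ∀ X Y Z → (X ◇₂ Y) ◇₂ Z ∼ X ◇₂ (Y ◇₂ Z)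
  ◇₂-assoc = ext₂-assoc m₂ m₂-assoc

  ◇₂-cong : {X X' Y Y' : V Forest²} → X ∼ X' → Y ∼ Y' → X ◇₂ Y ∼ X' ◇₂ Y'
  ◇₂-cong = ext₂-cong m₂

  ∙∙ : V Forest²
  ∙∙ = ⟦ (∙ , ∙) ⟧

  ◇₂-identityˡ : ∀ X → ∙∙ ◇₂ X ∼ X
  ◇₂-identityˡ X = ∼-trans (ext₂-⟦⟧ˡ m₂ (∙ , ∙) X) (∼-trans (ext-cong-fun X unit) (ext-⟦⟧-id X))
    where
    unit : ∀ q → m₂ (∙ , ∙) q ∼ ⟦ q ⟧
    unit (F , G) = ∼-trans (∼-reflexive (P.cong₂ _⊗_ (◇-identityˡ F) (◇-identityˡ G))) (⊗⟦⟧ F G)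

  ◇₂-identityʳ : ∀ X → X ◇₂ ∙∙ ∼ X
  ◇₂-identityʳ X = ∼-trans (ext₂-⟦⟧ʳ m₂ X (∙ , ∙)) (∼-trans (ext-cong-fun X unit) (ext-⟦⟧-id X))
    where
    unit : ∀ p → m₂ p (∙ , ∙) ∼ ⟦ p ⟧
    unit (F , G) = ∼-trans (∼-reflexive (P.cong₂ _⊗_ (◇-identityʳ F) (◇-identityʳ G))) (⊗⟦⟧ F G)

  ◇₂-·⟦⟧ˡ : ∀ a p q → (a ·ᵥ ⟦ p ⟧) ◇₂ ⟦ q ⟧ ∼ a ·ᵥ m₂ p q
  ◇₂-·⟦⟧ˡ a p q = ∼-trans (ext₂-·ˡ m₂ a ⟦ p ⟧ ⟦ q ⟧) (·-congˡ a (ext₂-⟦⟧⟦⟧ m₂ p q))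

  ◇₂-·⟦⟧ʳ : ∀ p a q → ⟦ p ⟧ ◇₂ (a ·ᵥ ⟦ q ⟧) ∼ a ·ᵥ m₂ p q
  ◇₂-·⟦⟧ʳ p a q = ∼-trans (ext₂-·ʳ m₂ a ⟦ p ⟧ ⟦ q ⟧) (·-congˡ a (ext₂-⟦⟧⟦⟧ m₂ p q))

module TensorRotaBaxter {c ℓ : Level} (K : CommutativeRing c ℓ) (λ' : CommutativeRing.Carrier K) where
  open CommutativeRing K
  open ADF K
  open Product λ'
  open Linear K
  open RotaBaxter K
  open ProductLaws K λ'
  open TensorSquare K λ'

  ev-ε-mapV : {B : Set} (h : B → Forest) (v : V B) → (∀ b → ε (h b) ≈ 0#) → ev ε (mapV h v) ≈ 0#
  ev-ε-mapV h v εh≈0 = trans (reflexive (ev-mapV ε h v)) (trans (ev-cong v εh≈0) (ev-zero v))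

  ε-◇ : ∀ F G → ev ε (F ◇ G) ≈ ε F * ε G
  ε-◇ (s ⟨ x ⟩ F) G = trans (ev-ε-mapV (s ⟨ x ⟩_) (F ◇ G) (λ _ → refl)) (sym (zeroˡ _))
  ε-◇ (last s) (t ⟨ y ⟩ G) = trans (ev-ε-mapV (_⟨ y ⟩ G) (s ◇ₜ t) (λ _ → refl)) (sym (zeroʳ _))
  ε-◇ (last leaf) (last t) = trans (ev-⟦⟧ ε (last t)) (sym (*-identityˡ _))
  ε-◇ (last (node a)) (last leaf) = trans (ev-⟦⟧ ε (last (node a))) (sym (zeroˡ _))
  ε-◇ (last (node a)) (last (node b)) =
    trans (reflexive (P.cong (ev ε) (B⁺-◇-B⁺ a b))) (trans (ev-ε-mapV B⁺ (ρ a b) (λ _ → refl)) (sym (zeroˡ _)))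

  εᵥ≡ev : ∀ v → εᵥ v ≡ ev ε v
  εᵥ≡ev [] = P.refl
  εᵥ≡ev ((k , F) ∷ v) = P.cong (k * ε F +_) (εᵥ≡ev v)

  εᵥ-◇ : ∀ F G → εᵥ (F ◇ G) ≈ ε F * ε G
  εᵥ-◇ F G = trans (reflexive (εᵥ≡ev (F ◇ G))) (ε-◇ F G)

  ε-B⁺-◇ : ∀ F G → ev ε (B⁺ F ◇ G) ≈ 0#
  ε-B⁺-◇ F G = trans (ε-◇ (B⁺ F) G) (zeroˡ _)

  ε-◇-B⁺ : ∀ F G → ev ε (F ◇ B⁺ G) ≈ 0#
  ε-◇-B⁺ F G = trans (ε-◇ F (B⁺ G)) (zeroʳ _)

  R²ᵥ : V Forest² → V Forest²
  R²ᵥ = ext R²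

  -- R² p is definitionally B⁺⊗id p ++ ε⊗B⁺ p.
  B⁺⊗id ε⊗B⁺ : Forest² → V Forest²
  B⁺⊗id (F , G) = ⟦ (B⁺ F , G) ⟧
  ε⊗B⁺ (F , G) = ε F ·ᵥ ⟦ (∙ , B⁺ G) ⟧

  B⁺⊗id-⊗ : ∀ v w → ext B⁺⊗id (v ⊗ w) ∼ mapV B⁺ v ⊗ w
  B⁺⊗id-⊗ v w = ∼-trans (ext-⊗ B⁺⊗id v w) (∼-sym (ext-mapV B⁺ (λ a → ext (pair a) w) v))

  ε⊗B⁺-⊗ : ∀ v w → ext ε⊗B⁺ (v ⊗ w) ∼ ev ε v ·ᵥ (⟦ ∙ ⟧ ⊗ mapV B⁺ w)
  ε⊗B⁺-⊗ v w =
    ext ε⊗B⁺ (v ⊗ w)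
      ∼⟨ ext-⊗ ε⊗B⁺ v w ⟩
    ext (λ a → ext (λ b → ε a ·ᵥ ⟦ (∙ , B⁺ b) ⟧) w) v
      ∼⟨ ext-cong-fun v (λ a → ext-·-fun (pair ∙ ∘ B⁺) (ε a) w) ⟩
    ext (λ a → ε a ·ᵥ ext (pair ∙ ∘ B⁺) w) v
      ∼⟨ ext-scalar ε (ext (pair ∙ ∘ B⁺) w) v ⟩
    ev ε v ·ᵥ ext (pair ∙ ∘ B⁺) w
      ∼⟨ ·-congˡ (ev ε v) •⊗B⁺ ⟨
    ev ε v ·ᵥ (⟦ ∙ ⟧ ⊗ mapV B⁺ w) ∼∎
    where
    •⊗B⁺ : ⟦ ∙ ⟧ ⊗ mapV B⁺ w ∼ ext (pair ∙ ∘ B⁺) w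
    •⊗B⁺ = ∼-trans (ext₂-⟦⟧ˡ pair ∙ (mapV B⁺ w)) (ext-mapV B⁺ (pair ∙) w)

  ◇₂-ε⊗B⁺ˡ : ∀ F G q → ε⊗B⁺ (F , G) ◇₂ ⟦ q ⟧ ∼ ε F ·ᵥ (⟦ proj₁ q ⟧ ⊗ (B⁺ G ◇ proj₂ q))
  ◇₂-ε⊗B⁺ˡ F G (F' , G') = ∼-trans (◇₂-·⟦⟧ˡ (ε F) (∙ , B⁺ G) (F' , G'))
    (·-congˡ (ε F) (∼-reflexive (P.cong (_⊗ (B⁺ G ◇ G')) (◇-identityˡ F'))))

  ◇₂-ε⊗B⁺ʳ : ∀ p F G → ⟦ p ⟧ ◇₂ ε⊗B⁺ (F , G) ∼ ε F ·ᵥ (⟦ proj₁ p ⟧ ⊗ (proj₂ p ◇ B⁺ G))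
  ◇₂-ε⊗B⁺ʳ (F' , G') F G = ∼-trans (◇₂-·⟦⟧ʳ (F' , G') (ε F) (∙ , B⁺ G))
    (·-congˡ (ε F) (∼-reflexive (P.cong (_⊗ (G' ◇ B⁺ G)) (◇-identityʳ F'))))

  ε⊗B⁺-·⟦⟧⊗ : ∀ a F w → ext ε⊗B⁺ (a ·ᵥ (⟦ F ⟧ ⊗ w)) ∼ (a * ε F) ·ᵥ (⟦ ∙ ⟧ ⊗ mapV B⁺ w)
  ε⊗B⁺-·⟦⟧⊗ a F w =
    ∼-trans (ext-· ε⊗B⁺ a (⟦ F ⟧ ⊗ w))
      (∼-trans (·-congˡ a (∼-trans (ε⊗B⁺-⊗ ⟦ F ⟧ w) (·-congʳ (⟦ ∙ ⟧ ⊗ mapV B⁺ w) (ev-⟦⟧ ε F))))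
               (·-· a (ε F) (⟦ ∙ ⟧ ⊗ mapV B⁺ w)))

  B⁺⊗id-rotaBaxter : IsRotaBaxter m₂ λ' B⁺⊗id
  B⁺⊗id-rotaBaxter (F , G) (F' , G') =
    ⟦ (B⁺ F , G) ⟧ ◇₂ ⟦ (B⁺ F' , G') ⟧
      ∼⟨ ext₂-⟦⟧⟦⟧ m₂ (B⁺ F , G) (B⁺ F' , G') ⟩
    (B⁺ F ◇ B⁺ F') ⊗ (G ◇ G')
      ∼≡⟨ P.cong (_⊗ (G ◇ G')) (B⁺-◇-B⁺ F F') ⟩
    mapV B⁺ (ρ F F') ⊗ (G ◇ G')
      ∼⟨ B⁺⊗id-⊗ (ρ F F') (G ◇ G') ⟨
    ext B⁺⊗id (ρ F F' ⊗ (G ◇ G'))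
      ∼⟨ ext-cong B⁺⊗id (⊗-++-++·ˡ (B⁺ F ◇ F') (F ◇ B⁺ F') (F ◇ F') (G ◇ G')) ⟩
    ext B⁺⊗id (m₂ (B⁺ F , G) q ++ (m₂ p (B⁺ F' , G') ++ λ' ·ᵥ m₂ p q))
      ∼⟨ ext-cong B⁺⊗id (++-cong (ext₂-⟦⟧⟦⟧ m₂ (B⁺ F , G) q)
                                 (++-congʳ (λ' ·ᵥ m₂ p q) (ext₂-⟦⟧⟦⟧ m₂ p (B⁺ F' , G')))) ⟨
    ext B⁺⊗id (⟦ (B⁺ F , G) ⟧ ◇₂ ⟦ q ⟧ ++ (⟦ p ⟧ ◇₂ ⟦ (B⁺ F' , G') ⟧ ++ λ' ·ᵥ m₂ p q)) ∼∎
    where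
    p = (F , G)
    q = (F' , G')

  ε⊗B⁺-rotaBaxter : IsRotaBaxter m₂ λ' ε⊗B⁺
  ε⊗B⁺-rotaBaxter (F , G) (F' , G') =
    (e ·ᵥ ⟦ (∙ , B⁺ G) ⟧) ◇₂ (e' ·ᵥ ⟦ (∙ , B⁺ G') ⟧)
      ∼⟨ ∼-trans (ext₂-·ˡ m₂ e ⟦ (∙ , B⁺ G) ⟧ (e' ·ᵥ ⟦ (∙ , B⁺ G') ⟧))
                 (·-congˡ e (◇₂-·⟦⟧ʳ (∙ , B⁺ G) e' (∙ , B⁺ G'))) ⟩
    e ·ᵥ (e' ·ᵥ ((∙ ◇ ∙) ⊗ (B⁺ G ◇ B⁺ G')))
      ∼⟨ ·-· e e' ((∙ ◇ ∙) ⊗ (B⁺ G ◇ B⁺ G')) ⟩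
    ee' ·ᵥ ((∙ ◇ ∙) ⊗ (B⁺ G ◇ B⁺ G'))
      ∼≡⟨ P.cong (λ u → ee' ·ᵥ u) (P.cong₂ _⊗_ (◇-identityˡ ∙) (P.trans (B⁺-◇-B⁺ G G') (mapV-ρ B⁺ G G'))) ⟩
    ee' ·ᵥ (⟦ ∙ ⟧ ⊗ (mapV B⁺ C ++ (mapV B⁺ C' ++ λ' ·ᵥ mapV B⁺ C₀)))
      ∼⟨ ·-congˡ ee' (⊗-++-++·ʳ ⟦ ∙ ⟧ (mapV B⁺ C) (mapV B⁺ C') (mapV B⁺ C₀)) ⟩
    ee' ·ᵥ (x ++ (y ++ λ' ·ᵥ z))
      ∼⟨ ·-++-++· ee' x y λ' z ⟩
    ee' ·ᵥ x ++ (ee' ·ᵥ y ++ ee' ·ᵥ (λ' ·ᵥ z))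
      ∼⟨ ++-cong first (++-cong second third) ⟨
    ext ε⊗B⁺ u ++ (ext ε⊗B⁺ u' ++ λ' ·ᵥ ext ε⊗B⁺ (m₂ p q))
      ∼⟨ ext-++-++· ε⊗B⁺ u u' λ' (m₂ p q) ⟨
    ext ε⊗B⁺ (u ++ (u' ++ λ' ·ᵥ m₂ p q))
      ∼⟨ ext-cong ε⊗B⁺ (++-cong (◇₂-ε⊗B⁺ˡ F G q) (++-congʳ (λ' ·ᵥ m₂ p q) (◇₂-ε⊗B⁺ʳ p F' G'))) ⟨
    ext ε⊗B⁺ (ε⊗B⁺ p ◇₂ ⟦ q ⟧ ++ (⟦ p ⟧ ◇₂ ε⊗B⁺ q ++ λ' ·ᵥ m₂ p q)) ∼∎
    where
    p = (F , G)
    q = (F' , G')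
    e = ε F
    e' = ε F'
    ee' = e * e'
    C = B⁺ G ◇ G'
    C' = G ◇ B⁺ G'
    C₀ = G ◇ G'
    x = ⟦ ∙ ⟧ ⊗ mapV B⁺ C
    y = ⟦ ∙ ⟧ ⊗ mapV B⁺ C'
    z = ⟦ ∙ ⟧ ⊗ mapV B⁺ C₀
    u = e ·ᵥ (⟦ F' ⟧ ⊗ C)
    u' = e' ·ᵥ (⟦ F ⟧ ⊗ C')
    first : ext ε⊗B⁺ u ∼ ee' ·ᵥ x
    first = ε⊗B⁺-·⟦⟧⊗ e F' C
    second : ext ε⊗B⁺ u' ∼ ee' ·ᵥ y
    second = ∼-trans (ε⊗B⁺-·⟦⟧⊗ e' F C') (·-congʳ y (*-comm e' e))
    third : λ' ·ᵥ ext ε⊗B⁺ (m₂ p q) ∼ ee' ·ᵥ (λ' ·ᵥ z)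
    third = ∼-trans (·-congˡ λ' (∼-trans (ε⊗B⁺-⊗ (F ◇ F') C₀) (·-congʳ z (ε-◇ F F')))) (·-comm λ' ee' z)

  B⁺⊗id-ε⊗B⁺ : ∀ p q → B⁺⊗id p ◇₂ ε⊗B⁺ q ∼ ext B⁺⊗id (⟦ p ⟧ ◇₂ ε⊗B⁺ q)
  B⁺⊗id-ε⊗B⁺ (F , G) (F' , G') =
    B⁺⊗id (F , G) ◇₂ ε⊗B⁺ (F' , G')              ∼⟨ ◇₂-ε⊗B⁺ʳ (B⁺ F , G) F' G' ⟩
    ε F' ·ᵥ (⟦ B⁺ F ⟧ ⊗ (G ◇ B⁺ G'))             ∼⟨ ·-congˡ (ε F') (B⁺⊗id-⊗ ⟦ F ⟧ (G ◇ B⁺ G')) ⟨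
    ε F' ·ᵥ ext B⁺⊗id (⟦ F ⟧ ⊗ (G ◇ B⁺ G'))      ∼⟨ ext-· B⁺⊗id (ε F') (⟦ F ⟧ ⊗ (G ◇ B⁺ G')) ⟨
    ext B⁺⊗id (ε F' ·ᵥ (⟦ F ⟧ ⊗ (G ◇ B⁺ G')))    ∼⟨ ext-cong B⁺⊗id (◇₂-ε⊗B⁺ʳ (F , G) F' G') ⟨
    ext B⁺⊗id (⟦ (F , G) ⟧ ◇₂ ε⊗B⁺ (F' , G'))    ∼∎

  ε⊗B⁺-B⁺⊗id : ∀ p q → ε⊗B⁺ p ◇₂ B⁺⊗id q ∼ ext B⁺⊗id (ε⊗B⁺ p ◇₂ ⟦ q ⟧)
  ε⊗B⁺-B⁺⊗id (F , G) (F' , G') =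
    ε⊗B⁺ (F , G) ◇₂ B⁺⊗id (F' , G')              ∼⟨ ◇₂-ε⊗B⁺ˡ F G (B⁺ F' , G') ⟩
    ε F ·ᵥ (⟦ B⁺ F' ⟧ ⊗ (B⁺ G ◇ G'))             ∼⟨ ·-congˡ (ε F) (B⁺⊗id-⊗ ⟦ F' ⟧ (B⁺ G ◇ G')) ⟨
    ε F ·ᵥ ext B⁺⊗id (⟦ F' ⟧ ⊗ (B⁺ G ◇ G'))      ∼⟨ ext-· B⁺⊗id (ε F) (⟦ F' ⟧ ⊗ (B⁺ G ◇ G')) ⟨
    ext B⁺⊗id (ε F ·ᵥ (⟦ F' ⟧ ⊗ (B⁺ G ◇ G')))    ∼⟨ ext-cong B⁺⊗id (◇₂-ε⊗B⁺ˡ F G (F' , G')) ⟨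
    ext B⁺⊗id (ε⊗B⁺ (F , G) ◇₂ ⟦ (F' , G') ⟧)    ∼∎

  ε⊗B⁺[B⁺⊗id·⟦⟧]≈0 : ∀ p q → ext ε⊗B⁺ (B⁺⊗id p ◇₂ ⟦ q ⟧) ∼ []
  ε⊗B⁺[B⁺⊗id·⟦⟧]≈0 (F , G) (F' , G') =
    ∼-trans (ext-cong ε⊗B⁺ (ext₂-⟦⟧⟦⟧ m₂ (B⁺ F , G) (F' , G')))
      (∼-trans (ε⊗B⁺-⊗ (B⁺ F ◇ F') (G ◇ G')) (≈0· (⟦ ∙ ⟧ ⊗ mapV B⁺ (G ◇ G')) (ε-B⁺-◇ F F')))

  ε⊗B⁺[⟦⟧·B⁺⊗id]≈0 : ∀ p q → ext ε⊗B⁺ (⟦ p ⟧ ◇₂ B⁺⊗id q) ∼ []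
  ε⊗B⁺[⟦⟧·B⁺⊗id]≈0 (F , G) (F' , G') =
    ∼-trans (ext-cong ε⊗B⁺ (ext₂-⟦⟧⟦⟧ m₂ (F , G) (B⁺ F' , G')))
      (∼-trans (ε⊗B⁺-⊗ (F ◇ B⁺ F') (G ◇ G')) (≈0· (⟦ ∙ ⟧ ⊗ mapV B⁺ (G ◇ G')) (ε-◇-B⁺ F F')))

  R²-rotaBaxter : ∀ X Y → R²ᵥ X ◇₂ R²ᵥ Y ∼ R²ᵥ (R²ᵥ X ◇₂ Y ++ (X ◇₂ R²ᵥ Y ++ λ' ·ᵥ (X ◇₂ Y)))
  R²-rotaBaxter = rotaBaxter-ext m₂ λ'
    (rotaBaxter-++ m₂ λ' B⁺⊗id-rotaBaxter ε⊗B⁺-rotaBaxter B⁺⊗id-ε⊗B⁺ ε⊗B⁺-B⁺⊗id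
                   ε⊗B⁺[B⁺⊗id·⟦⟧]≈0 ε⊗B⁺[⟦⟧·B⁺⊗id]≈0)

module Coproduct {c ℓ : Level} (K : CommutativeRing c ℓ) (λ' : CommutativeRing.Carrier K) where
  open ADF K
  open Product λ'
  open Linear K
  open ProductLaws K λ'
  open TensorSquare K λ'
  open TensorRotaBaxter K λ'

  Δgen : ℕ → V Forest²
  Δgen x = ⟦ (gen x , ∙) ⟧ ++ ⟦ (∙ , gen x) ⟧

  mutual
    δT : Tree → V Forest²
    δT leaf = ∙∙
    δT (node F) = R²ᵥ (δ F)

    δ : Forest → V Forest²
    δ (last t) = δT t
    δ (t ⟨ x ⟩ F) = δT t ◇₂ (Δgen x ◇₂ δ F)

  δ-gen : ∀ x → δ (gen x) ∼ Δgen x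
  δ-gen x = ∼-trans (◇₂-identityˡ (Δgen x ◇₂ ∙∙)) (◇₂-identityʳ (Δgen x))

  ext-◇₂-◇₂ : ∀ (X Y : V Forest²) (f : Forest → V Forest²) (L : V Forest) →
              ext (λ H → X ◇₂ (Y ◇₂ f H)) L ∼ X ◇₂ (Y ◇₂ ext f L)
  ext-◇₂-◇₂ X Y f L = ∼-trans (∼-sym (ext₂-extʳ m₂ (λ H → Y ◇₂ f H) X L))
                              (◇₂-cong (∼-refl {v = X}) (∼-sym (ext₂-extʳ m₂ f Y L)))

  ◇₂-reassoc : ∀ X Y Z W → X ◇₂ (Y ◇₂ (Z ◇₂ W)) ∼ (X ◇₂ (Y ◇₂ Z)) ◇₂ W
  ◇₂-reassoc X Y Z W =
    ∼-trans (◇₂-cong (∼-refl {v = X}) (∼-sym (◇₂-assoc Y Z W))) (∼-sym (◇₂-assoc X (Y ◇₂ Z) W))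

  mutual
    δ-◇ₜ : ∀ s t → ext δ (last s ◇ last t) ∼ δT s ◇₂ δT t
    δ-◇ₜ leaf t = ∼-trans (ext-⟦⟧ δ (last t)) (∼-sym (◇₂-identityˡ (δT t)))
    δ-◇ₜ (node A) leaf = ∼-trans (ext-⟦⟧ δ (last (node A))) (∼-sym (◇₂-identityʳ (δT (node A))))
    δ-◇ₜ (node A) (node A') =
      ext δ (mapV last (node A ◇ₜ node A'))
        ∼⟨ ext-cong δ (mapV-cong last (node-◇ₜ-node A A')) ⟩
      ext δ (mapV last (mapV node (ρ A A')))
        ∼⟨ ∼-trans (ext-mapV last δ (mapV node (ρ A A'))) (ext-mapV node δT (ρ A A')) ⟩
      ext (λ F → R²ᵥ (δ F)) (ρ A A')
        ∼⟨ ext-assoc δ R² (ρ A A') ⟨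
      R²ᵥ (ext δ (ρ A A'))
        ∼⟨ ext-cong R² δ-ρ ⟩
      R²ᵥ (R²ᵥ (δ A) ◇₂ δ A' ++ (δ A ◇₂ R²ᵥ (δ A') ++ λ' ·ᵥ (δ A ◇₂ δ A')))
                                                     ∼⟨ R²-rotaBaxter (δ A) (δ A') ⟨
      R²ᵥ (δ A) ◇₂ R²ᵥ (δ A')                        ∼∎
      where
      δ-ρ : ext δ (ρ A A') ∼ R²ᵥ (δ A) ◇₂ δ A' ++ (δ A ◇₂ R²ᵥ (δ A') ++ λ' ·ᵥ (δ A ◇₂ δ A'))
      δ-ρ = ∼-trans (ext-++-++· δ (B⁺ A ◇ A') (A ◇ B⁺ A') λ' (A ◇ A'))
              (++-cong (δ-tf (node A) A')
                (++-cong (∼-trans (ext-cong δ (∼-reflexive (ff-last A (node A')))) (δ-ft A (node A')))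
                         (·-congˡ λ' (δ-◇ A A'))))

    δ-tf : ∀ s G → ext δ (tf s G) ∼ δT s ◇₂ δ G
    δ-tf s (last t) = δ-◇ₜ s t
    δ-tf s (t ⟨ y ⟩ Q) =
      ext δ (mapV (_⟨ y ⟩ Q) (s ◇ₜ t))
        ∼⟨ ext-mapV (_⟨ y ⟩ Q) δ (s ◇ₜ t) ⟩
      ext (λ w → δT w ◇₂ (Δgen y ◇₂ δ Q)) (s ◇ₜ t)
        ∼⟨ ext₂-extˡ m₂ δT (s ◇ₜ t) (Δgen y ◇₂ δ Q) ⟨
      ext δT (s ◇ₜ t) ◇₂ (Δgen y ◇₂ δ Q)
        ∼⟨ ◇₂-cong (∼-trans (∼-sym (ext-mapV last δ (s ◇ₜ t))) (δ-◇ₜ s t))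
                   (∼-refl {v = Δgen y ◇₂ δ Q}) ⟩
      (δT s ◇₂ δT t) ◇₂ (Δgen y ◇₂ δ Q)
        ∼⟨ ◇₂-assoc (δT s) (δT t) (Δgen y ◇₂ δ Q) ⟩
      δT s ◇₂ δ (t ⟨ y ⟩ Q) ∼∎

    δ-ft : ∀ F t → ext δ (ft F t) ∼ δ F ◇₂ δT t
    δ-ft (last s) t = δ-◇ₜ s t
    δ-ft (s ⟨ x ⟩ F) t =
      ext δ (mapV (s ⟨ x ⟩_) (ft F t))
        ∼⟨ ext-mapV (s ⟨ x ⟩_) δ (ft F t) ⟩
      ext (λ H → δT s ◇₂ (Δgen x ◇₂ δ H)) (ft F t)
        ∼⟨ ext-◇₂-◇₂ (δT s) (Δgen x) δ (ft F t) ⟩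
      δT s ◇₂ (Δgen x ◇₂ ext δ (ft F t))
        ∼⟨ ◇₂-cong (∼-refl {v = δT s}) (◇₂-cong (∼-refl {v = Δgen x}) (δ-ft F t)) ⟩
      δT s ◇₂ (Δgen x ◇₂ (δ F ◇₂ δT t))
        ∼⟨ ◇₂-reassoc (δT s) (Δgen x) (δ F) (δT t) ⟩
      δ (s ⟨ x ⟩ F) ◇₂ δT t ∼∎

    δ-◇ : ∀ F G → ext δ (F ◇ G) ∼ δ F ◇₂ δ G
    δ-◇ (last s) G = δ-tf s G
    δ-◇ (s ⟨ x ⟩ F) G =
      ext δ (mapV (s ⟨ x ⟩_) (F ◇ G))
        ∼⟨ ext-mapV (s ⟨ x ⟩_) δ (F ◇ G) ⟩
      ext (λ H → δT s ◇₂ (Δgen x ◇₂ δ H)) (F ◇ G)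
        ∼⟨ ext-◇₂-◇₂ (δT s) (Δgen x) δ (F ◇ G) ⟩
      δT s ◇₂ (Δgen x ◇₂ ext δ (F ◇ G))
        ∼⟨ ◇₂-cong (∼-refl {v = δT s}) (◇₂-cong (∼-refl {v = Δgen x}) (δ-◇ F G)) ⟩
      δT s ◇₂ (Δgen x ◇₂ (δ F ◇₂ δ G))
        ∼⟨ ◇₂-reassoc (δT s) (Δgen x) (δ F) (δ G) ⟩
      δ (s ⟨ x ⟩ F) ◇₂ δ G ∼∎

module Freeness {c ℓ : Level} (K : CommutativeRing c ℓ) (λ' : CommutativeRing.Carrier K) where
  open ADF K
  open Product λ'
  open Linear K
  open TensorSquare K λ'
  open Coproduct K λ'

  -- φ behaves like the morphism out of the free Rota–Baxter algebra ADF that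
  -- sends •x• to g x, into an algebra with product ext₂ m and operator ext R.
  module _ {C : Set} (m : C → C → V C) (R : C → V C) (u : V C) (g : ℕ → V C) where
    record IsFreeMorphism (φ : Forest → V C) : Set (c ⊔ ℓ) where
      field
        φ-∙ : φ ∙ ∼ u
        φ-B⁺ : ∀ F → φ (B⁺ F) ∼ ext R (φ F)
        φ-graft : ∀ t x F → φ (t ⟨ x ⟩ F) ∼ ext₂ m (φ (last t)) (ext₂ m (g x) (φ F))
    open IsFreeMorphism

    freeMorphism-unique : ∀ {φ ψ} → IsFreeMorphism φ → IsFreeMorphism ψ → ∀ F → φ F ∼ ψ F
    freeMorphism-unique {φ} {ψ} isφ isψ = agree
      where
      mutual
        agreeT : ∀ t → φ (last t) ∼ ψ (last t)
        agreeT leaf = ∼-trans (φ-∙ isφ) (∼-sym (φ-∙ isψ))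
        agreeT (node F) = ∼-trans (φ-B⁺ isφ F) (∼-trans (ext-cong R (agree F)) (∼-sym (φ-B⁺ isψ F)))

        agree : ∀ F → φ F ∼ ψ F
        agree (last t) = agreeT t
        agree (t ⟨ x ⟩ F) =
          ∼-trans (φ-graft isφ t x F)
            (∼-trans (ext₂-cong m (agreeT t) (ext₂-cong m (∼-refl {v = g x}) (agree F)))
                     (∼-sym (φ-graft isψ t x F)))

    ext-δ-isFreeMorphism : (h : Forest² → V C) →
                           (∀ p q → ext h (m₂ p q) ∼ ext₂ m (h p) (h q)) →
                           (∀ p → ext h (R² p) ∼ ext R (h p)) →
                           h (∙ , ∙) ∼ u → (∀ x → ext h (Δgen x) ∼ g x) →
                           IsFreeMorphism (λ F → ext h (δ F))
    ext-δ-isFreeMorphism h h-◇ h-R² h-∙ h-gen = record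
      { φ-∙ = ∼-trans (ext-⟦⟧ h (∙ , ∙)) h-∙
      ; φ-B⁺ = λ F →
          ∼-trans (ext-assoc R² h (δ F)) (∼-trans (ext-cong-fun (δ F) h-R²) (∼-sym (ext-assoc h R (δ F))))
      ; φ-graft = λ t x F →
          ∼-trans (ext-multiplicative m₂ m h h-◇ (δT t) (Δgen x ◇₂ δ F))
            (ext₂-cong m (∼-refl {v = ext h (δT t)})
              (∼-trans (ext-multiplicative m₂ m h h-◇ (Δgen x) (δ F))
                       (ext₂-cong m (h-gen x) (∼-refl {v = ext h (δ F)}))))
      }

module Counit {c ℓ : Level} (K : CommutativeRing c ℓ) (λ' : CommutativeRing.Carrier K) where
  open CommutativeRing K
  open ADF K
  open Product λ'
  open Linear K
  open ProductLaws K λ'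
  open TensorSquare K λ'
  open TensorRotaBaxter K λ'
  open Coproduct K λ'
  open Freeness K λ'
  open import Relation.Binary.Reasoning.Setoid setoid

  ⟦B⁺⟧ : Forest → V Forest
  ⟦B⁺⟧ F = ⟦ B⁺ F ⟧

  ⟦gen⟧ : ℕ → V Forest
  ⟦gen⟧ x = ⟦ gen x ⟧

  ε⊗id id⊗ε : Forest² → V Forest
  ε⊗id (F , G) = ε F ·ᵥ ⟦ G ⟧
  id⊗ε (F , G) = ε G ·ᵥ ⟦ F ⟧

  ext-R² : {C : Set} (f : Forest² → V C) (G H : Forest) →
           ext f (R² (G , H)) ∼ f (B⁺ G , H) ++ ε G ·ᵥ f (∙ , B⁺ H)
  ext-R² f G H = ∼-trans (ext-++ f ⟦ (B⁺ G , H) ⟧ (ε G ·ᵥ ⟦ (∙ , B⁺ H) ⟧))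
    (++-cong (ext-⟦⟧ f (B⁺ G , H))
             (∼-trans (ext-· f (ε G) ⟦ (∙ , B⁺ H) ⟧) (·-congˡ (ε G) (ext-⟦⟧ f (∙ , B⁺ H)))))

  ·⟦⟧◇·⟦⟧ : ∀ a F b G → (a ·ᵥ ⟦ F ⟧) ◇ᵥ (b ·ᵥ ⟦ G ⟧) ∼ a ·ᵥ (b ·ᵥ (F ◇ G))
  ·⟦⟧◇·⟦⟧ a F b G =
    ∼-trans (ext₂-·ˡ _◇_ a ⟦ F ⟧ (b ·ᵥ ⟦ G ⟧))
            (·-congˡ a (∼-trans (ext₂-·ʳ _◇_ b ⟦ F ⟧ ⟦ G ⟧) (·-congˡ b (ext₂-⟦⟧⟦⟧ _◇_ F G))))

  ε⊗id-◇ : ∀ p q → ext ε⊗id (m₂ p q) ∼ ε⊗id p ◇ᵥ ε⊗id q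
  ε⊗id-◇ (F , G) (F' , G') =
    ext ε⊗id ((F ◇ F') ⊗ (G ◇ G'))                          ∼⟨ ext-⊗ ε⊗id (F ◇ F') (G ◇ G') ⟩
    ext (λ a → ext (λ b → ε a ·ᵥ ⟦ b ⟧) (G ◇ G')) (F ◇ F')
      ∼⟨ ext-cong-fun (F ◇ F') (λ a →
           ∼-trans (ext-·-fun ⟦_⟧ (ε a) (G ◇ G')) (·-congˡ (ε a) (ext-⟦⟧-id (G ◇ G')))) ⟩
    ext (λ a → ε a ·ᵥ (G ◇ G')) (F ◇ F')                    ∼⟨ ext-scalar ε (G ◇ G') (F ◇ F') ⟩
    ev ε (F ◇ F') ·ᵥ (G ◇ G')                               ∼⟨ ·-congʳ (G ◇ G') (ε-◇ F F') ⟩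
    (ε F * ε F') ·ᵥ (G ◇ G')                                ∼⟨ ·-· (ε F) (ε F') (G ◇ G') ⟨
    ε F ·ᵥ (ε F' ·ᵥ (G ◇ G'))                               ∼⟨ ·⟦⟧◇·⟦⟧ (ε F) G (ε F') G' ⟨
    (ε F ·ᵥ ⟦ G ⟧) ◇ᵥ (ε F' ·ᵥ ⟦ G' ⟧)                      ∼∎

  id⊗ε-◇ : ∀ p q → ext id⊗ε (m₂ p q) ∼ id⊗ε p ◇ᵥ id⊗ε q
  id⊗ε-◇ (F , G) (F' , G') =
    ext id⊗ε ((F ◇ F') ⊗ (G ◇ G'))
      ∼⟨ ext-⊗ id⊗ε (F ◇ F') (G ◇ G') ⟩
    ext (λ a → ext (λ b → ε b ·ᵥ ⟦ a ⟧) (G ◇ G')) (F ◇ F')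
      ∼⟨ ext-cong-fun (F ◇ F') (λ a → ext-scalar ε ⟦ a ⟧ (G ◇ G')) ⟩
    ext (λ a → ev ε (G ◇ G') ·ᵥ ⟦ a ⟧) (F ◇ F')
      ∼⟨ ∼-trans (ext-·-fun ⟦_⟧ (ev ε (G ◇ G')) (F ◇ F'))
                 (·-congˡ (ev ε (G ◇ G')) (ext-⟦⟧-id (F ◇ F'))) ⟩
    ev ε (G ◇ G') ·ᵥ (F ◇ F')                               ∼⟨ ·-congʳ (F ◇ F') (ε-◇ G G') ⟩
    (ε G * ε G') ·ᵥ (F ◇ F')                                ∼⟨ ·-· (ε G) (ε G') (F ◇ F') ⟨
    ε G ·ᵥ (ε G' ·ᵥ (F ◇ F'))                               ∼⟨ ·⟦⟧◇·⟦⟧ (ε G) F (ε G') F' ⟨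
    (ε G ·ᵥ ⟦ F ⟧) ◇ᵥ (ε G' ·ᵥ ⟦ F' ⟧)                      ∼∎

  ε⊗id-R² : ∀ p → ext ε⊗id (R² p) ∼ ext ⟦B⁺⟧ (ε⊗id p)
  ε⊗id-R² (F , G) =
    ext ε⊗id (R² (F , G))
      ∼⟨ ext-R² ε⊗id F G ⟩
    0# ·ᵥ ⟦ G ⟧ ++ ε F ·ᵥ (1# ·ᵥ ⟦ B⁺ G ⟧)
      ∼⟨ ++-cong (0· ⟦ G ⟧) (·-congˡ (ε F) (1· ⟦ B⁺ G ⟧)) ⟩
    ε F ·ᵥ ⟦ B⁺ G ⟧
      ∼⟨ ∼-trans (ext-· ⟦B⁺⟧ (ε F) ⟦ G ⟧) (·-congˡ (ε F) (ext-⟦⟧ ⟦B⁺⟧ G)) ⟨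
    ext ⟦B⁺⟧ (ε F ·ᵥ ⟦ G ⟧) ∼∎

  id⊗ε-R² : ∀ p → ext id⊗ε (R² p) ∼ ext ⟦B⁺⟧ (id⊗ε p)
  id⊗ε-R² (F , G) =
    ext id⊗ε (R² (F , G))
      ∼⟨ ext-R² id⊗ε F G ⟩
    ε G ·ᵥ ⟦ B⁺ F ⟧ ++ ε F ·ᵥ (0# ·ᵥ ⟦ ∙ ⟧)
      ∼⟨ ++-congˡ (ε G ·ᵥ ⟦ B⁺ F ⟧) (·-congˡ (ε F) (0· ⟦ ∙ ⟧)) ⟩
    ε G ·ᵥ ⟦ B⁺ F ⟧ ++ ε F ·ᵥ []
      ∼⟨ ++-identityʳ (ε G ·ᵥ ⟦ B⁺ F ⟧) ⟩
    ε G ·ᵥ ⟦ B⁺ F ⟧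
      ∼⟨ ∼-trans (ext-· ⟦B⁺⟧ (ε G) ⟦ F ⟧) (·-congˡ (ε G) (ext-⟦⟧ ⟦B⁺⟧ F)) ⟨
    ext ⟦B⁺⟧ (ε G ·ᵥ ⟦ F ⟧) ∼∎

  last-◇-gen-◇ : ∀ t x F → ⟦ last t ⟧ ◇ᵥ (⟦ gen x ⟧ ◇ᵥ ⟦ F ⟧) ∼ ⟦ t ⟨ x ⟩ F ⟧
  last-◇-gen-◇ t x F =
    ⟦ last t ⟧ ◇ᵥ (⟦ gen x ⟧ ◇ᵥ ⟦ F ⟧)
      ∼⟨ ext₂-cong _◇_ (∼-refl {v = ⟦ last t ⟧}) (ext₂-⟦⟧⟦⟧ _◇_ (gen x) F) ⟩
    ⟦ last t ⟧ ◇ᵥ (gen x ◇ F)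
      ∼≡⟨ P.cong (⟦ last t ⟧ ◇ᵥ_) (gen-◇ x F) ⟩
    ⟦ last t ⟧ ◇ᵥ ⟦ leaf ⟨ x ⟩ F ⟧
      ∼⟨ ext₂-⟦⟧⟦⟧ _◇_ (last t) (leaf ⟨ x ⟩ F) ⟩
    last t ◇ (leaf ⟨ x ⟩ F)
      ∼≡⟨ last-◇-leaf⟨⟩ t x F ⟩
    ⟦ t ⟨ x ⟩ F ⟧ ∼∎

  ⟦⟧-isFreeMorphism : IsFreeMorphism _◇_ ⟦B⁺⟧ ⟦ ∙ ⟧ ⟦gen⟧ ⟦_⟧
  ⟦⟧-isFreeMorphism = record
    { φ-∙ = ∼-refl
    ; φ-B⁺ = λ F → ∼-sym (ext-⟦⟧ ⟦B⁺⟧ F)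
    ; φ-graft = λ t x F → ∼-sym (last-◇-gen-◇ t x F)
    }

  counitˡ : ∀ F → ext ε⊗id (δ F) ∼ ⟦ F ⟧
  counitˡ = freeMorphism-unique _◇_ ⟦B⁺⟧ ⟦ ∙ ⟧ ⟦gen⟧
    (ext-δ-isFreeMorphism _◇_ ⟦B⁺⟧ ⟦ ∙ ⟧ ⟦gen⟧ ε⊗id ε⊗id-◇ ε⊗id-R² (1· ⟦ ∙ ⟧) gen-case)
    ⟦⟧-isFreeMorphism
    where
    gen-case : ∀ x → ext ε⊗id (Δgen x) ∼ ⟦ gen x ⟧
    gen-case x = ∼-trans (ext-⟦⟧++⟦⟧ ε⊗id (gen x , ∙) (∙ , gen x)) (++-cong (0· ⟦ ∙ ⟧) (1· ⟦ gen x ⟧))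

  counitʳ : ∀ F → ext id⊗ε (δ F) ∼ ⟦ F ⟧
  counitʳ = freeMorphism-unique _◇_ ⟦B⁺⟧ ⟦ ∙ ⟧ ⟦gen⟧
    (ext-δ-isFreeMorphism _◇_ ⟦B⁺⟧ ⟦ ∙ ⟧ ⟦gen⟧ id⊗ε id⊗ε-◇ id⊗ε-R² (1· ⟦ ∙ ⟧) gen-case)
    ⟦⟧-isFreeMorphism
    where
    gen-case : ∀ x → ext id⊗ε (Δgen x) ∼ ⟦ gen x ⟧
    gen-case x = ∼-trans (ext-⟦⟧++⟦⟧ id⊗ε (gen x , ∙) (∙ , gen x))
                   (∼-trans (++-cong (1· ⟦ gen x ⟧) (0· ⟦ ∙ ⟧)) (++-identityʳ ⟦ gen x ⟧))

  ε⊗ε-δ : ∀ F → ev (λ p → ε (proj₁ p) * ε (proj₂ p)) (δ F) ≈ ε F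
  ε⊗ε-δ F = begin
    ev (λ p → ε (proj₁ p) * ε (proj₂ p)) (δ F)  ≈⟨ ev-cong (δ F) ev-id⊗ε ⟨
    ev (λ p → ev ε (id⊗ε p)) (δ F)              ≈⟨ ev-ext ε id⊗ε (δ F) ⟨
    ev ε (ext id⊗ε (δ F))                        ≈⟨ ev-≈ (counitʳ F) ε ⟩
    ev ε ⟦ F ⟧                                   ≈⟨ ev-⟦⟧ ε F ⟩
    ε F                                          ∎
    where
    ev-id⊗ε : ∀ p → ev ε (id⊗ε p) ≈ ε (proj₁ p) * ε (proj₂ p)
    ev-id⊗ε (G , H) = trans (ev-· ε (ε H) ⟦ G ⟧) (trans (*-congˡ (ev-⟦⟧ ε G)) (*-comm _ _))

module Coassociativity {c ℓ : Level} (K : CommutativeRing c ℓ) (λ' : CommutativeRing.Carrier K) where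
  open CommutativeRing K
  open ADF K
  open Product λ'
  open Linear K
  open TensorSquare K λ'
  open TensorRotaBaxter K λ'
  open Coproduct K λ'
  open Freeness K λ'
  open Counit K λ'

  Forest³ = Forest × Forest × Forest

  snoc³ : Forest → Forest² → Forest³
  snoc³ H (F , G) = (F , G , H)

  cons³ : Forest → Forest² → Forest³
  cons³ F (G , H) = (F , G , H)

  _⊗id id⊗_ : (Forest → V Forest²) → Forest² → V Forest³
  (Δ ⊗id) (F , G) = mapV (snoc³ G) (Δ F)
  (id⊗ Δ) (F , G) = mapV (cons³ F) (Δ G)

  m₃ : Forest³ → Forest³ → V Forest³
  m₃ (F , G , H) (F' , G' , H') =
    ext (λ a → ext (λ b → ext (λ c → ⟦ (a , b , c) ⟧) (H ◇ H')) (G ◇ G')) (F ◇ F')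

  R³ : Forest³ → V Forest³
  R³ (F , G , H) =
    ⟦ (B⁺ F , G , H) ⟧ ++ (ε F ·ᵥ ⟦ (∙ , B⁺ G , H) ⟧ ++ ε F ·ᵥ (ε G ·ᵥ ⟦ (∙ , ∙ , B⁺ H) ⟧))

  Δgen³ : ℕ → V Forest³
  Δgen³ x = ⟦ (gen x , ∙ , ∙) ⟧ ++ (⟦ (∙ , gen x , ∙) ⟧ ++ ⟦ (∙ , ∙ , gen x) ⟧)

  δ⊗id-◇ : ∀ p q → ext (δ ⊗id) (m₂ p q) ∼ ext₂ m₃ ((δ ⊗id) p) ((δ ⊗id) q)
  δ⊗id-◇ (F , G) (F' , G') =
    ext (δ ⊗id) ((F ◇ F') ⊗ (G ◇ G'))
      ∼⟨ ext-⊗ (δ ⊗id) (F ◇ F') (G ◇ G') ⟩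
    ext (λ a → ext (λ b → mapV (snoc³ b) (δ a)) (G ◇ G')) (F ◇ F')
      ∼⟨ ext-cong-fun (F ◇ F') (λ a → ext-cong-fun (G ◇ G') (λ b → mapV-as-ext (snoc³ b) (δ a))) ⟩
    ext (λ a → ext (λ b → ext (λ r → ⟦ snoc³ b r ⟧) (δ a)) (G ◇ G')) (F ◇ F')
      ∼⟨ ext-cong-fun (F ◇ F') (λ a → ext-swap (λ b r → ⟦ snoc³ b r ⟧) (G ◇ G') (δ a)) ⟩
    ext (λ a → ext h (δ a)) (F ◇ F')
      ∼⟨ ext-assoc δ h (F ◇ F') ⟨
    ext h (ext δ (F ◇ F'))
      ∼⟨ ext-cong h (δ-◇ F F') ⟩
    ext h (δ F ◇₂ δ F')
      ∼⟨ ext-ext₂ h m₂ (δ F) (δ F') ⟩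
    ext₂ (λ u v → ext h (m₂ u v)) (δ F) (δ F')
      ∼⟨ ext₂-cong-fun (δ F) (δ F') (λ u v → ext-⊗ h (proj₁ u ◇ proj₁ v) (proj₂ u ◇ proj₂ v)) ⟩
    ext₂ (λ u v → m₃ (snoc³ G u) (snoc³ G' v)) (δ F) (δ F')
      ∼⟨ ext₂-mapV m₃ (snoc³ G) (snoc³ G') (δ F) (δ F') ⟨
    ext₂ m₃ ((δ ⊗id) (F , G)) ((δ ⊗id) (F' , G')) ∼∎
    where
    h : Forest² → V Forest³
    h r = ext (λ b → ⟦ snoc³ b r ⟧) (G ◇ G')

  id⊗δ-◇ : ∀ p q → ext (id⊗ δ) (m₂ p q) ∼ ext₂ m₃ ((id⊗ δ) p) ((id⊗ δ) q)
  id⊗δ-◇ (F , G) (F' , G') =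
    ext (id⊗ δ) ((F ◇ F') ⊗ (G ◇ G'))
      ∼⟨ ext-⊗ (id⊗ δ) (F ◇ F') (G ◇ G') ⟩
    ext (λ a → ext (λ b → mapV (cons³ a) (δ b)) (G ◇ G')) (F ◇ F')
      ∼⟨ ext-cong-fun (F ◇ F') (λ a → ext-cong-fun (G ◇ G') (λ b → mapV-as-ext (cons³ a) (δ b))) ⟩
    ext (λ a → ext (λ b → ext (h a) (δ b)) (G ◇ G')) (F ◇ F')
      ∼⟨ ext-cong-fun (F ◇ F') (λ a → ext-assoc δ (h a) (G ◇ G')) ⟨
    ext (λ a → ext (h a) (ext δ (G ◇ G'))) (F ◇ F')
      ∼⟨ ext-cong-fun (F ◇ F') (λ a → ext-cong (h a) (δ-◇ G G')) ⟩
    ext (λ a → ext (h a) (δ G ◇₂ δ G')) (F ◇ F')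
      ∼⟨ ext-cong-fun (F ◇ F') (λ a → ext-ext₂ (h a) m₂ (δ G) (δ G')) ⟩
    ext (λ a → ext₂ (λ u v → ext (h a) (m₂ u v)) (δ G) (δ G')) (F ◇ F')
      ∼⟨ ext-swap (λ a u → ext (λ v → ext (h a) (m₂ u v)) (δ G')) (F ◇ F') (δ G) ⟩
    ext (λ u → ext (λ a → ext (λ v → ext (h a) (m₂ u v)) (δ G')) (F ◇ F')) (δ G)
      ∼⟨ ext-cong-fun (δ G) (λ u → ext-swap (λ a v → ext (h a) (m₂ u v)) (F ◇ F') (δ G')) ⟩
    ext₂ (λ u v → ext (λ a → ext (h a) (m₂ u v)) (F ◇ F')) (δ G) (δ G')
      ∼⟨ ext₂-cong-fun (δ G) (δ G') (λ u v →
           ext-cong-fun (F ◇ F') (λ a → ext-⊗ (h a) (proj₁ u ◇ proj₁ v) (proj₂ u ◇ proj₂ v))) ⟩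
    ext₂ (λ u v → m₃ (cons³ F u) (cons³ F' v)) (δ G) (δ G')
      ∼⟨ ext₂-mapV m₃ (cons³ F) (cons³ F') (δ G) (δ G') ⟨
    ext₂ m₃ ((id⊗ δ) (F , G)) ((id⊗ δ) (F' , G')) ∼∎
    where
    h : Forest → Forest² → V Forest³
    h a r = ⟦ cons³ a r ⟧

  -- The ε G summand of R² (G , H) is absorbed using ε G = Σ ε G₁ ε G₂ over δ G.
  δ⊗id-R² : ∀ p → ext (δ ⊗id) (R² p) ∼ ext R³ ((δ ⊗id) p)
  δ⊗id-R² (G , H) =
    ext (δ ⊗id) (R² (G , H))
      ∼⟨ ext-R² (δ ⊗id) G H ⟩
    mapV (snoc³ H) (R²ᵥ (δ G)) ++ ε G ·ᵥ w
      ∼⟨ ++-cong (mapV-ext (snoc³ H) R² (δ G)) (·-congʳ w (sym (ε⊗ε-δ G))) ⟩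
    ext (λ r → mapV (snoc³ H) (R² r)) (δ G) ++ ev (λ r → ε (proj₁ r) * ε (proj₂ r)) (δ G) ·ᵥ w
      ∼⟨ ++-congˡ (ext (λ r → mapV (snoc³ H) (R² r)) (δ G)) εε-sum ⟨
    ext (λ r → mapV (snoc³ H) (R² r)) (δ G) ++ ext k (δ G)
      ∼⟨ ext-++-fun (λ r → mapV (snoc³ H) (R² r)) k (δ G) ⟨
    ext (λ r → mapV (snoc³ H) (R² r) ++ k r) (δ G)
      ∼⟨ ext-cong-fun (δ G) (λ { (G₁ , G₂) →
           ++-assoc ⟦ (B⁺ G₁ , G₂ , H) ⟧ (ε G₁ ·ᵥ ⟦ (∙ , B⁺ G₂ , H) ⟧) (k (G₁ , G₂)) }) ⟩
    ext (λ r → R³ (snoc³ H r)) (δ G)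
      ∼⟨ ext-mapV (snoc³ H) R³ (δ G) ⟨
    ext R³ (mapV (snoc³ H) (δ G)) ∼∎
    where
    w = ⟦ (∙ , ∙ , B⁺ H) ⟧
    k : Forest² → V Forest³
    k (G₁ , G₂) = ε G₁ ·ᵥ (ε G₂ ·ᵥ w)
    εε-sum : ext k (δ G) ∼ ev (λ r → ε (proj₁ r) * ε (proj₂ r)) (δ G) ·ᵥ w
    εε-sum = ∼-trans (ext-cong-fun (δ G) (λ { (G₁ , G₂) → ·-· (ε G₁) (ε G₂) w }))
                     (ext-scalar (λ r → ε (proj₁ r) * ε (proj₂ r)) w (δ G))

  id⊗δ-R² : ∀ p → ext (id⊗ δ) (R² p) ∼ ext R³ ((id⊗ δ) p)
  id⊗δ-R² (G , H) =
    ext (id⊗ δ) (R² (G , H))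
      ∼⟨ ext-R² (id⊗ δ) G H ⟩
    mapV (cons³ (B⁺ G)) (δ H) ++ ε G ·ᵥ mapV (cons³ ∙) (R²ᵥ (δ H))
      ∼⟨ ++-cong (mapV-as-ext (cons³ (B⁺ G)) (δ H)) (·-congˡ (ε G) (mapV-ext (cons³ ∙) R² (δ H))) ⟩
    ext (λ r → ⟦ cons³ (B⁺ G) r ⟧) (δ H) ++ ε G ·ᵥ ext (λ r → mapV (cons³ ∙) (R² r)) (δ H)
      ∼⟨ ∼-trans (ext-++-fun (λ r → ⟦ cons³ (B⁺ G) r ⟧) (λ r → ε G ·ᵥ mapV (cons³ ∙) (R² r)) (δ H))
                 (++-congˡ (ext (λ r → ⟦ cons³ (B⁺ G) r ⟧) (δ H))
                           (ext-·-fun (λ r → mapV (cons³ ∙) (R² r)) (ε G) (δ H))) ⟨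
    ext (λ r → ⟦ cons³ (B⁺ G) r ⟧ ++ ε G ·ᵥ mapV (cons³ ∙) (R² r)) (δ H)
      ∼⟨ ext-cong-fun (δ H) (λ { (H₁ , H₂) →
           ++-congˡ ⟦ (B⁺ G , H₁ , H₂) ⟧
                    (·-++ (ε G) ⟦ (∙ , B⁺ H₁ , H₂) ⟧ (ε H₁ ·ᵥ ⟦ (∙ , ∙ , B⁺ H₂) ⟧)) }) ⟩
    ext (λ r → R³ (cons³ G r)) (δ H)
      ∼⟨ ext-mapV (cons³ G) R³ (δ H) ⟨
    ext R³ (mapV (cons³ G) (δ H)) ∼∎

  δ⊗id-gen : ∀ x → ext (δ ⊗id) (Δgen x) ∼ Δgen³ x
  δ⊗id-gen x = ∼-trans (ext-⟦⟧++⟦⟧ (δ ⊗id) (gen x , ∙) (∙ , gen x))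
    (∼-trans (++-congʳ ⟦ (∙ , ∙ , gen x) ⟧ (mapV-cong (snoc³ ∙) (δ-gen x)))
      (++-assoc ⟦ (gen x , ∙ , ∙) ⟧ ⟦ (∙ , gen x , ∙) ⟧ ⟦ (∙ , ∙ , gen x) ⟧))

  id⊗δ-gen : ∀ x → ext (id⊗ δ) (Δgen x) ∼ Δgen³ x
  id⊗δ-gen x = ∼-trans (ext-⟦⟧++⟦⟧ (id⊗ δ) (gen x , ∙) (∙ , gen x))
    (++-congˡ ⟦ (gen x , ∙ , ∙) ⟧ (mapV-cong (cons³ ∙) (δ-gen x)))

  coassoc : ∀ F → ext (δ ⊗id) (δ F) ∼ ext (id⊗ δ) (δ F)
  coassoc = freeMorphism-unique m₃ R³ ⟦ (∙ , ∙ , ∙) ⟧ Δgen³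
    (ext-δ-isFreeMorphism m₃ R³ _ _ (δ ⊗id) δ⊗id-◇ δ⊗id-R² ∼-refl δ⊗id-gen)
    (ext-δ-isFreeMorphism m₃ R³ _ _ (id⊗ δ) id⊗δ-◇ id⊗δ-R² ∼-refl id⊗δ-gen)

module Support {c ℓ : Level} (K : CommutativeRing c ℓ) where
  open CommutativeRing K
  open ADF K
  open Linear K

  Supported : {B : Set} → (B → Set) → V B → Set (c ⊔ ℓ)
  Supported P v = All (λ { (k , b) → k ≈ 0# ⊎ P b }) v

  Supported-⟦⟧ : ∀ {B : Set} {P : B → Set} {b} → P b → Supported P ⟦ b ⟧
  Supported-⟦⟧ p = inj₂ p ∷ []

  Supported-++ : ∀ {B : Set} {P : B → Set} {v w : V B} → Supported P v → Supported P w → Supported P (v ++ w)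
  Supported-++ = AllP.++⁺

  Supported-· : ∀ {B : Set} {P : B → Set} a {v : V B} → Supported P v → Supported P (a ·ᵥ v)
  Supported-· a [] = []
  Supported-· a (inj₁ k≈0 ∷ s) = inj₁ (trans (*-congˡ k≈0) (zeroʳ a)) ∷ Supported-· a s
  Supported-· a (inj₂ p ∷ s) = inj₂ p ∷ Supported-· a s

  module _ {B : Set} {P : B → Set} where
    Supported-mapV : ∀ {C : Set} {Q : C → Set} (h : B → C) → (∀ b → P b → Q (h b)) →
                     ∀ {v} → Supported P v → Supported Q (mapV h v)
    Supported-mapV h f [] = []
    Supported-mapV h f (inj₁ k≈0 ∷ s) = inj₁ k≈0 ∷ Supported-mapV h f s
    Supported-mapV h f {(k , b) ∷ _} (inj₂ p ∷ s) = inj₂ (f b p) ∷ Supported-mapV h f s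

    Supported-ext : ∀ {C : Set} {Q : C → Set} (f : B → V C) → (∀ b → P b → Supported Q (f b)) →
                    ∀ {v} → Supported P v → Supported Q (ext f v)
    Supported-ext f e [] = []
    Supported-ext {C} {Q} f e {(k , b) ∷ v} (inj₁ k≈0 ∷ s) = Supported-++ (vanishing (f b)) (Supported-ext f e s)
      where
      vanishing : ∀ (w : V C) → Supported Q (k ·ᵥ w)
      vanishing [] = []
      vanishing (_ ∷ w) = inj₁ (trans (*-congʳ k≈0) (zeroˡ _)) ∷ vanishing w
    Supported-ext f e {(k , b) ∷ v} (inj₂ p ∷ s) = Supported-++ (Supported-· k (e b p)) (Supported-ext f e s)

    Supported-coeff : (d : DecidableEquality B) → ∀ {v} → Supported P v → ∀ b → ¬ P b → coeff d v b ≈ 0#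
    Supported-coeff d [] b ¬p = refl
    Supported-coeff d {(k , b') ∷ v} (_ ∷ s) b ¬p with d b' b
    ... | no _ = Supported-coeff d s b ¬p
    Supported-coeff d {(k , b') ∷ v} (inj₁ k≈0 ∷ s) b ¬p | yes _ =
      trans (+-cong k≈0 (Supported-coeff d s b ¬p)) (+-identityˡ 0#)
    Supported-coeff d {(k , b') ∷ v} (inj₂ p ∷ s) b ¬p | yes P.refl = ⊥-elim (¬p p)

    Supported-ext-cong : ∀ {C : Set} {f f' : B → V C} {v} → Supported P v →
                         (∀ b → P b → f b ∼ f' b) → ext f v ∼ ext f' v
    Supported-ext-cong [] e = ∼-refl
    Supported-ext-cong {f = f} {f'} {v = (k , b) ∷ v} (inj₁ k≈0 ∷ s) e =
      ++-cong (∼-trans (≈0· (f b) k≈0) (∼-sym (≈0· (f' b) k≈0))) (Supported-ext-cong s e)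
    Supported-ext-cong {v = (k , b) ∷ v} (inj₂ p ∷ s) e = ++-cong (·-congˡ k (e b p)) (Supported-ext-cong s e)

  Supported-ext₂ : ∀ {B C D : Set} {P : B → Set} {P' : C → Set} {Q : D → Set} (m : B → C → V D) →
                   (∀ b c → P b → P' c → Supported Q (m b c)) →
                   ∀ {v w} → Supported P v → Supported P' w → Supported Q (ext₂ m v w)
  Supported-ext₂ m e sv sw = Supported-ext _ (λ b pb → Supported-ext (m b) (λ c pc → e b c pb pc) sw) sv

module Grading {c ℓ : Level} (K : CommutativeRing c ℓ) (λ' : CommutativeRing.Carrier K) where
  open CommutativeRing K
  open ADF K
  open Product λ'
  open Linear K
  open Support K
  open TensorSquare K λ'
  open Coproduct K λ'

  HasLabelsT : List ℕ → Tree → Set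
  HasLabelsT L t = labelsT t ≡ L

  HasLabels : List ℕ → Forest → Set
  HasLabels L F = labels F ≡ L

  HasLabels² : List ℕ → Forest² → Set
  HasLabels² L (F , G) = labels F ++ labels G ↭ L

  mutual
    ◇ₜ-labels : ∀ s t → Supported (HasLabelsT (labelsT s ++ labelsT t)) (s ◇ₜ t)
    ◇ₜ-labels leaf t = Supported-⟦⟧ P.refl
    ◇ₜ-labels (node a) leaf = Supported-⟦⟧ (P.sym (LP.++-identityʳ (labels a)))
    ◇ₜ-labels (node a) (node b) =
      Supported-++ (Supported-mapV node (λ _ p → p) (tf-labels (node a) b))
        (Supported-++ (Supported-mapV node (λ _ p → p) (ft-labels a (node b)))
                      (Supported-· λ' (Supported-mapV node (λ _ p → p) (◇-labels a b))))

    tf-labels : ∀ s G → Supported (HasLabels (labelsT s ++ labels G)) (tf s G)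
    tf-labels s (last t) = Supported-mapV last (λ _ p → p) (◇ₜ-labels s t)
    tf-labels s (t ⟨ y ⟩ Q) = Supported-mapV (_⟨ y ⟩ Q)
      (λ _ p → P.trans (P.cong (_++ (y ∷ labels Q)) p) (LP.++-assoc (labelsT s) (labelsT t) _)) (◇ₜ-labels s t)

    ft-labels : ∀ F t → Supported (HasLabels (labels F ++ labelsT t)) (ft F t)
    ft-labels (last s) t = Supported-mapV last (λ _ p → p) (◇ₜ-labels s t)
    ft-labels (s ⟨ x ⟩ F) t = Supported-mapV (s ⟨ x ⟩_)
      (λ _ p → P.trans (P.cong (λ l → labelsT s ++ (x ∷ l)) p) (P.sym (LP.++-assoc (labelsT s) (x ∷ labels F) (labelsT t))))
      (ft-labels F t)

    ◇-labels : ∀ F G → Supported (HasLabels (labels F ++ labels G)) (F ◇ G)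
    ◇-labels (last s) G = tf-labels s G
    ◇-labels (s ⟨ x ⟩ F) G = Supported-mapV (s ⟨ x ⟩_)
      (λ _ p → P.trans (P.cong (λ l → labelsT s ++ (x ∷ l)) p) (P.sym (LP.++-assoc (labelsT s) (x ∷ labels F) (labels G))))
      (◇-labels F G)

  m₂-labels : ∀ L L' p q → HasLabels² L p → HasLabels² L' q → Supported (HasLabels² (L ++ L')) (m₂ p q)
  m₂-labels L L' (F , G) (F' , G') FG↭L F'G'↭L' =
    Supported-ext₂ pair
      (λ a b a-labels b-labels → Supported-⟦⟧
        (↭-trans (↭-reflexive (P.cong₂ _++_ a-labels b-labels))
          (↭-trans (↭-interchange (labels F) (labels F') (labels G) (labels G'))
            (↭-trans (PmP.++⁺ʳ _ FG↭L) (PmP.++⁺ˡ L F'G'↭L')))))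
      (◇-labels F F') (◇-labels G G')

  ◇₂-labels : ∀ L L' {X Y} → Supported (HasLabels² L) X → Supported (HasLabels² L') Y →
              Supported (HasLabels² (L ++ L')) (X ◇₂ Y)
  ◇₂-labels L L' = Supported-ext₂ m₂ (m₂-labels L L')

  R²-labels : ∀ L p → HasLabels² L p → Supported (HasLabels² L) (R² p)
  R²-labels L (G , H) GH↭L with G ≟F ∙
  ... | yes P.refl = Supported-++ (Supported-⟦⟧ GH↭L) (Supported-· 1# (Supported-⟦⟧ GH↭L))
  ... | no _ = Supported-++ (Supported-⟦⟧ GH↭L) (inj₁ (zeroˡ 1#) ∷ [])

  Δgen-labels : ∀ {x} → Supported (HasLabels² (x ∷ [])) (Δgen x)
  Δgen-labels {x} = Supported-++ (Supported-⟦⟧ {b = (gen x , ∙)} ↭-refl) (Supported-⟦⟧ {b = (∙ , gen x)} ↭-refl)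

  mutual
    δT-labels : ∀ t → Supported (HasLabels² (labelsT t)) (δT t)
    δT-labels leaf = Supported-⟦⟧ ↭-refl
    δT-labels (node A) = Supported-ext R² (R²-labels (labels A)) (δ-labels A)

    δ-labels : ∀ F → Supported (HasLabels² (labels F)) (δ F)
    δ-labels (last t) = δT-labels t
    δ-labels (t ⟨ x ⟩ F) =
      ◇₂-labels (labelsT t) (x ∷ labels F) (δT-labels t)
        (◇₂-labels (x ∷ []) (labels F) Δgen-labels (δ-labels F))

  δ-ext-cong : ∀ {C : Set} {f f' : Forest² → V C} F → WellLabelled F →
               (∀ G H → WellLabelled G → WellLabelled H → f (G , H) ∼ f' (G , H)) → ext f (δ F) ∼ ext f' (δ F)
  δ-ext-cong {f = f} {f'} F wl f≈f' = Supported-ext-cong (δ-labels F) agree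
    where
    agree : ∀ p → HasLabels² (labels F) p → f p ∼ f' p
    agree (G , H) GH↭F = f≈f' G H (Unique-++⁻ˡ (labels G) wlGH) (Unique-++⁻ʳ (labels G) wlGH)
      where wlGH = Unique-resp-↭ (↭-sym GH↭F) wl

module Naturality {c ℓ : Level} (K : CommutativeRing c ℓ) (λ' : CommutativeRing.Carrier K) (σ : ℕ → ℕ) where
  open ADF K
  open Product λ'
  open Linear K
  open TensorSquare K λ'
  open Coproduct K λ'
  open Freeness K λ'

  r = relabel σ
  rT = relabelT σ

  r² : Forest² → Forest²
  r² (F , G) = (r F , r G)

  ⟦r²⟧ : Forest² → V Forest²
  ⟦r²⟧ p = ⟦ r² p ⟧

  ε-relabel : ∀ F → ε (r F) ≡ ε F
  ε-relabel (last leaf) = P.refl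
  ε-relabel (last (node F)) = P.refl
  ε-relabel (t ⟨ x ⟩ F) = P.refl

  mutual
    ◇ₜ-relabel : ∀ s t → rT s ◇ₜ rT t ∼ mapV rT (s ◇ₜ t)
    ◇ₜ-relabel leaf t = ∼-refl
    ◇ₜ-relabel (node a) leaf = ∼-refl
    ◇ₜ-relabel (node a) (node b) =
      mapV node (tf (node (r a)) (r b)) ++ (mapV node (ft (r a) (node (r b))) ++ λ' ·ᵥ mapV node (r a ◇ r b))
        ∼⟨ ++-cong (mapV-cong node (tf-relabel (node a) b))
                   (++-cong (mapV-cong node (ft-relabel a (node b))) (·-congˡ λ' (mapV-cong node (◇-relabel a b)))) ⟩
      mapV node (mapV r X₁) ++ (mapV node (mapV r X₂) ++ λ' ·ᵥ mapV node (mapV r X₃))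
        ∼≡⟨ P.cong₂ _++_ (node-r X₁) (P.cong₂ _++_ (node-r X₂) (P.cong (λ' ·ᵥ_) (node-r X₃))) ⟩
      mapV rT (mapV node X₁) ++ (mapV rT (mapV node X₂) ++ λ' ·ᵥ mapV rT (mapV node X₃))
        ∼≡⟨ P.sym (P.trans (mapV-++ rT (mapV node X₁) _) (P.cong (mapV rT (mapV node X₁) ++_)
               (P.trans (mapV-++ rT (mapV node X₂) _) (P.cong (mapV rT (mapV node X₂) ++_) (mapV-· rT λ' (mapV node X₃)))))) ⟩
      mapV rT (node a ◇ₜ node b)
        ∼∎
      where
      X₁ = tf (node a) b
      X₂ = ft a (node b)
      X₃ = a ◇ b
      node-r : ∀ X → mapV node (mapV r X) ≡ mapV rT (mapV node X)
      node-r X = P.trans (mapV-∘ r node X) (P.sym (mapV-∘ node rT X))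

    tf-relabel : ∀ s G → tf (rT s) (r G) ∼ mapV r (tf s G)
    tf-relabel s (last t) =
      ∼-trans (mapV-cong last (◇ₜ-relabel s t)) (∼-reflexive (P.trans (mapV-∘ rT last _) (P.sym (mapV-∘ last r _))))
    tf-relabel s (t ⟨ y ⟩ Q) =
      ∼-trans (mapV-cong (_⟨ σ y ⟩ r Q) (◇ₜ-relabel s t))
              (∼-reflexive (P.trans (mapV-∘ rT (_⟨ σ y ⟩ r Q) _) (P.sym (mapV-∘ (_⟨ y ⟩ Q) r _))))

    ft-relabel : ∀ F t → ft (r F) (rT t) ∼ mapV r (ft F t)
    ft-relabel (last s) t =
      ∼-trans (mapV-cong last (◇ₜ-relabel s t)) (∼-reflexive (P.trans (mapV-∘ rT last _) (P.sym (mapV-∘ last r _))))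
    ft-relabel (s ⟨ x ⟩ F) t =
      ∼-trans (mapV-cong (rT s ⟨ σ x ⟩_) (ft-relabel F t))
              (∼-reflexive (P.trans (mapV-∘ r (rT s ⟨ σ x ⟩_) _) (P.sym (mapV-∘ (s ⟨ x ⟩_) r _))))

    ◇-relabel : ∀ F G → r F ◇ r G ∼ mapV r (F ◇ G)
    ◇-relabel (last s) G = tf-relabel s G
    ◇-relabel (s ⟨ x ⟩ F) G =
      ∼-trans (mapV-cong (rT s ⟨ σ x ⟩_) (◇-relabel F G))
              (∼-reflexive (P.trans (mapV-∘ r (rT s ⟨ σ x ⟩_) _) (P.sym (mapV-∘ (s ⟨ x ⟩_) r _))))

  ⊗-relabel : ∀ v w → mapV r v ⊗ mapV r w ∼ ext ⟦r²⟧ (v ⊗ w)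
  ⊗-relabel v w =
    mapV r v ⊗ mapV r w                        ∼⟨ ext₂-mapV pair r r v w ⟩
    ext₂ (λ a b → ⟦ (r a , r b) ⟧) v w         ∼⟨ ext₂-cong-fun v w (λ a b → ext-⟦⟧ ⟦r²⟧ (a , b)) ⟨
    ext₂ (λ a b → ext ⟦r²⟧ (pair a b)) v w     ∼⟨ ext-ext₂ ⟦r²⟧ pair v w ⟨
    ext ⟦r²⟧ (v ⊗ w)                           ∼∎

  m₂-relabel : ∀ p q → ext ⟦r²⟧ (m₂ p q) ∼ ext₂ m₂ (⟦r²⟧ p) (⟦r²⟧ q)
  m₂-relabel (F , G) (F' , G') =
    ext ⟦r²⟧ ((F ◇ F') ⊗ (G ◇ G'))             ∼⟨ ⊗-relabel (F ◇ F') (G ◇ G') ⟨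
    mapV r (F ◇ F') ⊗ mapV r (G ◇ G')          ∼⟨ ⊗-cong (◇-relabel F F') (◇-relabel G G') ⟨
    m₂ (r² (F , G)) (r² (F' , G'))             ∼⟨ ext₂-⟦⟧⟦⟧ m₂ (r² (F , G)) (r² (F' , G')) ⟨
    ext₂ m₂ (⟦r²⟧ (F , G)) (⟦r²⟧ (F' , G'))    ∼∎

  R²-relabel : ∀ p → ext ⟦r²⟧ (R² p) ∼ ext R² (⟦r²⟧ p)
  R²-relabel (G , H) =
    ext ⟦r²⟧ (R² (G , H))
      ∼⟨ mapV-as-ext r² (R² (G , H)) ⟨
    mapV r² (R² (G , H))
      ∼≡⟨ P.cong (λ e → ⟦ (B⁺ (r G) , r H) ⟧ ++ e ·ᵥ ⟦ (∙ , B⁺ (r H)) ⟧) (P.sym (ε-relabel G)) ⟩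
    R² (r² (G , H))
      ∼⟨ ext-⟦⟧ R² (r² (G , H)) ⟨
    ext R² (⟦r²⟧ (G , H)) ∼∎

  δ-relabel : ∀ F → δ (r F) ∼ mapV r² (δ F)
  δ-relabel F = ∼-trans (freeMorphism-unique m₂ R² ∙∙ (Δgen ∘ σ) δ∘r-isFree ext-⟦r²⟧-δ-isFree F)
                        (∼-sym (mapV-as-ext r² (δ F)))
    where
    δ∘r-isFree : IsFreeMorphism m₂ R² ∙∙ (Δgen ∘ σ) (δ ∘ r)
    δ∘r-isFree = record { φ-∙ = ∼-refl ; φ-B⁺ = λ _ → ∼-refl ; φ-graft = λ _ _ _ → ∼-refl }
    ext-⟦r²⟧-δ-isFree : IsFreeMorphism m₂ R² ∙∙ (Δgen ∘ σ) (λ F → ext ⟦r²⟧ (δ F))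
    ext-⟦r²⟧-δ-isFree = ext-δ-isFreeMorphism m₂ R² ∙∙ (Δgen ∘ σ) ⟦r²⟧ m₂-relabel R²-relabel ∼-refl
                          (λ x → ext-⟦⟧++⟦⟧ ⟦r²⟧ (gen x , ∙) (∙ , gen x))

module Bialgebra {c ℓ : Level} (K : CommutativeRing c ℓ) (λ' : CommutativeRing.Carrier K) where
  open CommutativeRing K
  open ADF K
  open Product λ'
  open Linear K
  open Support K
  open ProductLaws K λ'
  open TensorSquare K λ'
  open TensorRotaBaxter K λ'
  open Coproduct K λ'
  open Counit K λ'
  open Coassociativity K λ'
  open Grading K λ'
  module Coeff₁ = Coefficients _≟F_
  module Coeff₂ = Coefficients _≟F²_
  module Coeff₃ = Coefficients _≟F³_

  δ-isDelta : IsDelta λ' δ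
  δ-isDelta = record
    { graded = λ F _ G H GH≁F → Supported-coeff _≟F²_ (δ-labels F) (G , H) GH≁F
    ; natural = λ σ _ F _ → Coeff₂.∼⇒≈ (Naturality.δ-relabel K λ' σ F)
    ; mult = λ F G _ _ _ → Coeff₂.∼⇒≈ (δ-◇ F G)
    ; unit = Coeff₂.∼⇒≈ (∼-refl {v = ∙∙})
    ; rb = λ F _ → Coeff₂.∼⇒≈ (∼-refl {v = δ (B⁺ F)})
    ; gens = λ x → Coeff₂.∼⇒≈ (δ-gen x)
    }

  module _ (δ' : Forest → V Forest²) (isDelta : IsDelta λ' δ') where
    open IsDelta isDelta

    δ'-◇ : ∀ F G H → F ◇ G ≡ ⟦ H ⟧ →
           WellLabelled F → WellLabelled G → Disjoint (labels F) (labels G) → δ' H ∼ δ' F ◇₂ δ' G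
    δ'-◇ F G H F◇G≡H wlF wlG F#G =
      δ' H              ∼⟨ ext-⟦⟧ δ' H ⟨
      ext δ' ⟦ H ⟧      ∼≡⟨ P.cong (ext δ') (P.sym F◇G≡H) ⟩
      ext δ' (F ◇ G)    ∼⟨ Coeff₂.≈⇒∼ (ext δ' (F ◇ G)) (δ' F ◇₂ δ' G) (mult F G wlF wlG F#G) ⟩
      δ' F ◇₂ δ' G      ∼∎

    δ'-graft : ∀ t x F → WellLabelled (t ⟨ x ⟩ F) → δ' (t ⟨ x ⟩ F) ∼ δ' (last t) ◇₂ (Δgen x ◇₂ δ' F)
    δ'-graft t x F wl =
      δ' (t ⟨ x ⟩ F)
        ∼⟨ δ'-◇ (last t) (leaf ⟨ x ⟩ F) (t ⟨ x ⟩ F) (last-◇-leaf⟨⟩ t x F)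
                wellLabelled-head wellLabelled-leaf⟨⟩ disjoint-head ⟩
      δ' (last t) ◇₂ δ' (leaf ⟨ x ⟩ F)
        ∼⟨ ◇₂-cong (∼-refl {v = δ' (last t)})
                   (δ'-◇ (gen x) F (leaf ⟨ x ⟩ F) (gen-◇ x F) ([] ∷ []) wellLabelled-tail disjoint-gen) ⟩
      δ' (last t) ◇₂ (δ' (gen x) ◇₂ δ' F)
        ∼⟨ ◇₂-cong (∼-refl {v = δ' (last t)})
                   (◇₂-cong (Coeff₂.≈⇒∼ (δ' (gen x)) (Δgen x) (gens x)) (∼-refl {v = δ' F})) ⟩
      δ' (last t) ◇₂ (Δgen x ◇₂ δ' F) ∼∎
      where open WellLabelledGraft t x F wl

    mutual
      δ-uniqueT : ∀ t → WellLabelled (last t) → δ' (last t) ∼ δT t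
      δ-uniqueT leaf _ = Coeff₂.≈⇒∼ (δ' ∙) ∙∙ unit
      δ-uniqueT (node A) wl =
        ∼-trans (Coeff₂.≈⇒∼ (δ' (B⁺ A)) (R²ᵥ (δ' A)) (rb A wl)) (ext-cong R² (δ-unique A wl))

      δ-unique : ∀ F → WellLabelled F → δ' F ∼ δ F
      δ-unique (last t) wl = δ-uniqueT t wl
      δ-unique (t ⟨ x ⟩ F) wl =
        ∼-trans (δ'-graft t x F wl)
          (◇₂-cong (δ-uniqueT t wellLabelled-head) (◇₂-cong (∼-refl {v = Δgen x}) (δ-unique F wellLabelled-tail)))
        where open WellLabelledGraft t x F wl

    δ'-coassoc : ∀ F → WellLabelled F → ext (δ' ⊗id) (δ' F) ∼ ext (id⊗ δ') (δ' F)
    δ'-coassoc F wl =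
      ext (δ' ⊗id) (δ' F)   ∼⟨ ext-cong (δ' ⊗id) (δ-unique F wl) ⟩
      ext (δ' ⊗id) (δ F)    ∼⟨ δ-ext-cong F wl (λ G H wlG _ → mapV-cong (snoc³ H) (δ-unique G wlG)) ⟩
      ext (δ ⊗id) (δ F)     ∼⟨ coassoc F ⟩
      ext (id⊗ δ) (δ F)     ∼⟨ δ-ext-cong F wl (λ G H _ wlH → mapV-cong (cons³ G) (δ-unique H wlH)) ⟨
      ext (id⊗ δ') (δ F)    ∼⟨ ext-cong (id⊗ δ') (δ-unique F wl) ⟨
      ext (id⊗ δ') (δ' F)   ∼∎

    isTwistedBialgebra : IsTwistedBialgebra λ' δ'
    isTwistedBialgebra = record
      { m-natural = λ σ _ F G _ _ _ → Coeff₁.∼⇒≈ (Naturality.◇-relabel K λ' σ F G)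
      ; m-assoc = λ F G H _ _ _ _ _ _ → Coeff₁.∼⇒≈ (◇-assoc-⟦⟧ F G H)
      ; m-unitˡ = λ F _ → Coeff₁.∼⇒≈ (∼-reflexive (◇-identityˡ F))
      ; m-unitʳ = λ F _ → Coeff₁.∼⇒≈ (∼-reflexive (◇-identityʳ F))
      ; Δ-graded = graded
      ; Δ-natural = natural
      ; ε-natural = λ σ _ F _ → reflexive (Naturality.ε-relabel K λ' σ F)
      ; coassoc = λ F wl → Coeff₃.∼⇒≈ (δ'-coassoc F wl)
      ; counitˡ = λ F wl → Coeff₁.∼⇒≈ (∼-trans (ext-cong ε⊗id (δ-unique F wl)) (counitˡ F))
      ; counitʳ = λ F wl → Coeff₁.∼⇒≈ (∼-trans (ext-cong id⊗ε (δ-unique F wl)) (counitʳ F))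
      ; Δ-mult = mult
      ; Δ-unit = unit
      ; ε-mult = λ F G _ _ _ → εᵥ-◇ F G
      ; ε-unit = refl
      }

theorem3p11 : ∀ {c ℓ : Level} (K : CommutativeRing c ℓ) → IsField K → CharZero K →
    (λ' : CommutativeRing.Carrier K) → ADF.Theorem3p11 K λ'
theorem3p11 K _ _ λ' = (δ , δ-isDelta) , isTwistedBialgebra
  where
  open Coproduct K λ' using (δ)
  open Bialgebra K λ'
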